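{- For $n\ge1$ let $\mathbb{G}_n$ be the weighted multigraph on vertices $v_1,v_1',\dots,v_n,v_n'$ whose edges are: for each $k=1,\dots,n-1$, the four edges $v_kv_{k+1}$, $v_kv_{k+1}'$, $v_k'v_{k+1}$, $v_k'v_{k+1}'$, each with resistance $2^{ -k}$; and two parallel edges between $v_n$ and $v_n'$, each with resistance $2^{ -(n-1)}$. Let $L(\mathbb{G}_n)$ be its Laplacian matrix and $\psi_n(\lambda)=\det(\lambda I-L(\mathbb{G}_n))$. Define polynomials $g_k(\lambda)$ by $g_0(\lambda)=1$, $g_1(\lambda)=\lambda-4$ and \[g_k(\lambda)=(\lambda-3\cdot 2^k)g_{k-1}(\lambda)-2^{2k}g_{k-2}(\lambda)\qquad(k\ge2).\] Then $\psi_1(\lambda)=\lambda(\lambda-4)$ and, for $n\ge 2$, \[\psi_n(\lambda)=\Big((\lambda-2^n)g_{n-1}(\lambda)-4^{n}g_{n-2}(\lambda)\Big)(\lambda-4)\prod_{i=2}^n(\lambda-3\cdot 2^i).\]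
   Context: For a weighted multigraph in which each edge $e$ has a positive resistance $r_e$ (conductance $1/r_e$), the Laplacian matrix $L$ is indexed by the vertices, with $L_{uu}$ equal to the sum of conductances $1/r_e$ over all edges $e$ incident to $u$, and for $u\ne v$, $L_{uv}$ equal to minus the sum of conductances of all edges joining $u$ and $v$ (parallel edges contribute separately). Equivalently $L=QR^{ -1}Q^T$ with $Q$ an oriented vertex-edge incidence matrix and $R$ the diagonal matrix of edge resistances. -}

module Defs where

open import Data.Nat as ℕ using (ℕ; zero; suc)
open import Data.Integer as ℤ using (ℤ; +_; 0ℤ; 1ℤ)
open import Data.Fin as Fin using (Fin; zero; suc; toℕ; combine; inject₁; fromℕ; punchIn)
open import Data.List as List using (List; []; _∷_; map; foldr; concatMap; allFin; upTo; _++_)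
open import Data.Bool using (Bool; true; false; if_then_else_; _∨_; _∧_)
open import Data.Product using (_×_; _,_)
open import Relation.Binary.PropositionalEquality using (_≡_)
open import Relation.Nullary.Decidable using (⌊_⌋)

-- Polynomials over ℤ, as coefficient lists (lowest degree first).

Poly : Set
Poly = List ℤ

coeff : Poly → ℕ → ℤ
coeff []       _       = 0ℤ
coeff (a ∷ p)  zero    = a
coeff (a ∷ p)  (suc i) = coeff p i

-- equality of polynomials: all coefficients agree (trailing zeros irrelevant)
infix 4 _≈ₚ_
_≈ₚ_ : Poly → Poly → Set
p ≈ₚ q = ∀ i → coeff p i ≡ coeff q i

infixl 6 _+ₚ_ _-ₚ_
infixl 7 _*ₚ_

_+ₚ_ : Poly → Poly → Poly
[]      +ₚ q       = q
(a ∷ p) +ₚ []      = a ∷ p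
(a ∷ p) +ₚ (b ∷ q) = (a ℤ.+ b) ∷ (p +ₚ q)

-ₚ_ : Poly → Poly
-ₚ p = map ℤ.-_ p

_-ₚ_ : Poly → Poly → Poly
p -ₚ q = p +ₚ (-ₚ q)

_*ₚ_ : Poly → Poly → Poly
[]      *ₚ q = []
(a ∷ p) *ₚ q = map (a ℤ.*_) q +ₚ (0ℤ ∷ (p *ₚ q))

C : ℤ → Poly
C c = c ∷ []

X : Poly
X = 0ℤ ∷ 1ℤ ∷ []

prodₚ : List Poly → Poly
prodₚ = foldr _*ₚ_ (C 1ℤ)

sumₚ : List Poly → Poly
sumₚ = foldr _+ₚ_ []

Matrix : Set → ℕ → Set
Matrix A n = Fin n → Fin n → A

sign : ℕ → Poly
sign zero          = C 1ℤ
sign (suc zero)    = C (ℤ.- 1ℤ)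
sign (suc (suc k)) = sign k

det : ∀ n → Matrix Poly n → Poly
det zero    M = C 1ℤ
det (suc n) M = sumₚ (map (λ i → sign (toℕ i) *ₚ M i zero *ₚ
                           det n (λ a b → M (punchIn i a) (suc b)))
                          (allFin (suc n)))

-- Weighted multigraphs.  Each edge records its two endpoints and its
-- conductance 1/r_e (here always a positive integer, since all
-- resistances in the graphs considered are of the form 2^{-k}).

record Edge (V : ℕ) : Set where
  constructor edge
  field
    end₁ end₂   : Fin V
    conductance : ℕ

record WMultigraph : Set where
  field
    V     : ℕ
    edges : List (Edge V)

open Edge

_==_ : ∀ {V} → Fin V → Fin V → Bool
u == v = ⌊ u Fin.≟ v ⌋

sumℤ : List ℤ → ℤ
sumℤ = foldr ℤ._+_ 0ℤ

laplacian : (G : WMultigraph) → Matrix ℤ (WMultigraph.V G)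
laplacian G u v =
  if u == v
  then sumℤ (map (λ e → if (end₁ e == u) ∨ (end₂ e == u) then + conductance e else 0ℤ) Es)
  else ℤ.- sumℤ (map (λ e → if ((end₁ e == u) ∧ (end₂ e == v)) ∨ ((end₁ e == v) ∧ (end₂ e == u))
                            then + conductance e else 0ℤ) Es)
  where Es = WMultigraph.edges G

charPoly : (G : WMultigraph) → Poly
charPoly G = det (WMultigraph.V G)
  (λ u v → (if u == v then X else []) -ₚ C (laplacian G u v))

-- The graph 𝔾_n, for n = suc m ≥ 1.
-- Vertex v_k (k = 1..n) is  combine (k-1) 0, and v_k' is combine (k-1) 1.

vtx : ∀ {n} → Fin n → Fin 2 → Fin (n ℕ.* 2)
vtx = combine

𝔾 : ℕ → WMultigraph
𝔾 m = record
  { V     = suc m ℕ.* 2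
  ; edges = concatMap (λ (k : Fin m) →
               -- k here is k' - 1 for the paper's k' = 1..n-1; resistance 2^{-k'}
               let c = 2 ℕ.^ suc (toℕ k) in
               edge (vtx (inject₁ k) zero)      (vtx (suc k) zero)      c ∷
               edge (vtx (inject₁ k) zero)      (vtx (suc k) (suc zero)) c ∷
               edge (vtx (inject₁ k) (suc zero)) (vtx (suc k) zero)      c ∷
               edge (vtx (inject₁ k) (suc zero)) (vtx (suc k) (suc zero)) c ∷ [])
             (allFin m)
           ++ ( edge (vtx (fromℕ m) zero) (vtx (fromℕ m) (suc zero)) (2 ℕ.^ m)
              ∷ edge (vtx (fromℕ m) zero) (vtx (fromℕ m) (suc zero)) (2 ℕ.^ m) ∷ [])
  }

ψ : (n : ℕ) → Poly
ψ zero    = C 1ℤ   -- unused (𝔾_n is only defined for n ≥ 1)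
ψ (suc m) = charPoly (𝔾 m)

g : ℕ → Poly
g zero          = C 1ℤ
g (suc zero)    = X -ₚ C (+ 4)
g (suc (suc k)) = (X -ₚ C (+ (3 ℕ.* 2 ℕ.^ (suc (suc k))))) *ₚ g (suc k)
                  -ₚ C (+ (2 ℕ.^ (2 ℕ.* suc (suc k)))) *ₚ g k

prodFactor : ℕ → Poly
prodFactor n = prodₚ (map (λ i → X -ₚ C (+ (3 ℕ.* 2 ℕ.^ i))) (List.drop 2 (upTo (suc n))))

{-# OPTIONS --safe #-}
-- In 𝔾ₙ the two vertices v_k, v_k' of each level are twins: they have the same
-- neighbours through the same conductances.  So λI − L splits into an
-- antisymmetric part (x at v_k, −x at v_k'), on which it is diagonal with
-- entries λ − d_k, the last one lowered further by the weight e between v_n and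
-- v_n', and a symmetric part, on which it is tridiagonal with diagonal λ − d_k,
-- the last one raised by e, and off-diagonal products 4c_k², whose determinant is
-- a continuant.  Without a change of basis, the same factorisation follows from a
-- three-term recurrence obtained by expanding along the first column and
-- subtracting twin rows.  In 𝔾ₙ the degrees are 4, 3·2^i (1 < i < n) and 2^{n+1},
-- the couplings c_k = 2^k and e = 2^n, which turns the product into
-- (λ − 4) ∏ (λ − 3·2^i) and the continuant into (λ − 2^n) g_{n−1} − 4^n g_{n−2}.
module Submission where

open import Defs
open import Data.Nat using (ℕ; suc; _^_)
open import Data.Integer using (+_)
open import Data.Product using (_×_)

open import Data.Nat as ℕ using (zero; _<_; z<s; s<s)
import Data.Nat.Properties as ℕP
open import Data.Nat.Tactic.RingSolver using (solve-∀)
open import Data.Integer as ℤ using (ℤ; 0ℤ; 1ℤ)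
import Data.Integer.Properties as ℤP
open import Data.Fin as Fin using (Fin; zero; suc; toℕ; punchIn; punchOut; inject₁; fromℕ)
open import Data.Fin.Properties using (punchIn-punchOut; punchIn-injective; punchInᵢ≢i)
open import Data.Bool using (true; false; if_then_else_; _∨_; _∧_)
open import Data.Bool.Properties using (∧-zeroʳ)
open import Data.List using (List; []; _∷_; map; tabulate; applyUpTo; _++_; concat; concatMap; allFin)
import Data.List.Properties as ListP
open import Data.Maybe using (Maybe)
import Data.Maybe as Maybe
open import Data.Product using (_,_)
open import Data.Sum using (inj₁; inj₂)
open import Data.Empty using (⊥-elim)
open import Data.Vec.Functional using (Vector; updateAt)
open import Data.Vec.Functional.Properties using (updateAt-updates; updateAt-minimal)
open import Algebra.Bundles using (CommutativeRing)
open import Algebra.Structures using (IsCommutativeRing)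
import Algebra.Solver.Ring
open import Algebra.Solver.Ring.AlmostCommutativeRing
  using (_-Raw-AlmostCommutative⟶_; fromCommutativeRing)
import Relation.Binary.Reasoning.Setoid
open import Relation.Binary.PropositionalEquality
  using (_≡_; _≢_; refl; sym; trans; cong; cong₂; subst; module ≡-Reasoning)
open import Relation.Nullary using (yes; no)
open import Relation.Nullary.Decidable using (dec⇒maybe)

-- The polynomial ring ℤ[X]

-- A record rather than a synonym for _≈ₚ_, so that both polynomials can be
-- inferred from a proof.
infix 4 _≈_
record _≈_ (p q : Poly) : Set where
  constructor mk
  field get : p ≈ₚ q
open _≈_

≈-refl : ∀ {p} → p ≈ p
≈-refl = mk λ _ → refl

≈-sym : ∀ {p q} → p ≈ q → q ≈ p
≈-sym p≈q = mk λ i → sym (get p≈q i)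

≈-trans : ∀ {p q r} → p ≈ q → q ≈ r → p ≈ r
≈-trans p≈q q≈r = mk λ i → trans (get p≈q i) (get q≈r i)

≡⇒≈ : ∀ {p q} → p ≡ q → p ≈ q
≡⇒≈ refl = ≈-refl

∷-cong : ∀ {a b p q} → a ≡ b → p ≈ q → a ∷ p ≈ b ∷ q
∷-cong a≡b p≈q = mk λ { zero → a≡b ; (suc i) → get p≈q i }

∷-zero : ∀ {a p} → a ≡ 0ℤ → p ≈ [] → a ∷ p ≈ []
∷-zero a≡0 p≈[] = mk λ { zero → a≡0 ; (suc i) → get p≈[] i }

infixl 7 _·_
_·_ : ℤ → Poly → Poly
a · q = map (a ℤ.*_) q

coeff-+ₚ : ∀ p q i → coeff (p +ₚ q) i ≡ coeff p i ℤ.+ coeff q i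
coeff-+ₚ []      q       i       = sym (ℤP.+-identityˡ _)
coeff-+ₚ (a ∷ p) []      i       = sym (ℤP.+-identityʳ _)
coeff-+ₚ (a ∷ p) (b ∷ q) zero    = refl
coeff-+ₚ (a ∷ p) (b ∷ q) (suc i) = coeff-+ₚ p q i

coeff--ₚ : ∀ p i → coeff (-ₚ p) i ≡ ℤ.- coeff p i
coeff--ₚ []      i       = refl
coeff--ₚ (a ∷ p) zero    = refl
coeff--ₚ (a ∷ p) (suc i) = coeff--ₚ p i

coeff-· : ∀ a q i → coeff (a · q) i ≡ a ℤ.* coeff q i
coeff-· a []      i       = sym (ℤP.*-zeroʳ a)
coeff-· a (b ∷ q) zero    = refl
coeff-· a (b ∷ q) (suc i) = coeff-· a q i

+ₚ-cong : ∀ {p p′ q q′} → p ≈ p′ → q ≈ q′ → p +ₚ q ≈ p′ +ₚ q′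
+ₚ-cong {p} {p′} {q} {q′} p≈p′ q≈q′ = mk λ i →
  trans (coeff-+ₚ p q i)
    (trans (cong₂ ℤ._+_ (get p≈p′ i) (get q≈q′ i)) (sym (coeff-+ₚ p′ q′ i)))

-ₚ-cong : ∀ {p p′} → p ≈ p′ → -ₚ p ≈ -ₚ p′
-ₚ-cong {p} {p′} p≈p′ = mk λ i →
  trans (coeff--ₚ p i) (trans (cong ℤ.-_ (get p≈p′ i)) (sym (coeff--ₚ p′ i)))

·-congʳ : ∀ a {q q′} → q ≈ q′ → a · q ≈ a · q′
·-congʳ a {q} {q′} q≈q′ = mk λ i →
  trans (coeff-· a q i) (trans (cong (a ℤ.*_) (get q≈q′ i)) (sym (coeff-· a q′ i)))

+ₚ-congˡ : ∀ p {q q′} → q ≈ q′ → p +ₚ q ≈ p +ₚ q′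
+ₚ-congˡ p = +ₚ-cong (≈-refl {p})

+ₚ-assoc : ∀ p q r → (p +ₚ q) +ₚ r ≈ p +ₚ (q +ₚ r)
+ₚ-assoc []      q       r       = ≈-refl
+ₚ-assoc (a ∷ p) []      r       = ≈-refl
+ₚ-assoc (a ∷ p) (b ∷ q) []      = ≈-refl
+ₚ-assoc (a ∷ p) (b ∷ q) (c ∷ r) = ∷-cong (ℤP.+-assoc a b c) (+ₚ-assoc p q r)

+ₚ-identityˡ : ∀ p → [] +ₚ p ≈ p
+ₚ-identityˡ p = ≈-refl

+ₚ-identityʳ : ∀ p → p +ₚ [] ≈ p
+ₚ-identityʳ []      = ≈-refl
+ₚ-identityʳ (a ∷ p) = ≈-refl

+ₚ-comm : ∀ p q → p +ₚ q ≈ q +ₚ p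
+ₚ-comm []      q       = ≈-sym (+ₚ-identityʳ q)
+ₚ-comm (a ∷ p) []      = ≈-refl
+ₚ-comm (a ∷ p) (b ∷ q) = ∷-cong (ℤP.+-comm a b) (+ₚ-comm p q)

-ₚ-inverseʳ : ∀ p → p +ₚ (-ₚ p) ≈ []
-ₚ-inverseʳ []      = ≈-refl
-ₚ-inverseʳ (a ∷ p) = ∷-zero (ℤP.+-inverseʳ a) (-ₚ-inverseʳ p)

-ₚ-inverseˡ : ∀ p → (-ₚ p) +ₚ p ≈ []
-ₚ-inverseˡ p = ≈-trans (+ₚ-comm (-ₚ p) p) (-ₚ-inverseʳ p)

+ₚ-interchange : ∀ p q r s → (p +ₚ q) +ₚ (r +ₚ s) ≈ (p +ₚ r) +ₚ (q +ₚ s)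
+ₚ-interchange p q r s =
  ≈-trans (+ₚ-assoc p q (r +ₚ s))
    (≈-trans (+ₚ-cong (≈-refl {p})
               (≈-trans (≈-sym (+ₚ-assoc q r s))
                 (≈-trans (+ₚ-cong (+ₚ-comm q r) ≈-refl) (+ₚ-assoc r q s))))
      (≈-sym (+ₚ-assoc p r (q +ₚ s))))

·-distrib-+ₚ : ∀ a q r → a · (q +ₚ r) ≈ a · q +ₚ a · r
·-distrib-+ₚ a []      r       = ≈-refl
·-distrib-+ₚ a (b ∷ q) []      = ≈-refl
·-distrib-+ₚ a (b ∷ q) (c ∷ r) = ∷-cong (ℤP.*-distribˡ-+ a b c) (·-distrib-+ₚ a q r)

·-assoc : ∀ a b q → a · (b · q) ≈ (a ℤ.* b) · q
·-assoc a b []      = ≈-refl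
·-assoc a b (c ∷ q) = ∷-cong (sym (ℤP.*-assoc a b c)) (·-assoc a b q)

·-zeroˡ : ∀ q → 0ℤ · q ≈ []
·-zeroˡ []      = ≈-refl
·-zeroˡ (b ∷ q) = ∷-zero refl (·-zeroˡ q)

·-identityˡ : ∀ q → 1ℤ · q ≈ q
·-identityˡ []      = ≈-refl
·-identityˡ (b ∷ q) = ∷-cong (ℤP.*-identityˡ b) (·-identityˡ q)

*ₚ-congʳ : ∀ p {q q′} → q ≈ q′ → p *ₚ q ≈ p *ₚ q′
*ₚ-congʳ []      q≈q′ = ≈-refl
*ₚ-congʳ (a ∷ p) q≈q′ = +ₚ-cong (·-congʳ a q≈q′) (∷-cong refl (*ₚ-congʳ p q≈q′))

*ₚ-zeroʳ : ∀ p → p *ₚ [] ≈ []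
*ₚ-zeroʳ []      = ≈-refl
*ₚ-zeroʳ (a ∷ p) = ∷-zero refl (*ₚ-zeroʳ p)

*ₚ-∷ʳ : ∀ p a q → p *ₚ (a ∷ q) ≈ a · p +ₚ (0ℤ ∷ (p *ₚ q))
*ₚ-∷ʳ []      a q = ≈-sym (∷-zero refl ≈-refl)
*ₚ-∷ʳ (b ∷ p) a q = ∷-cong (cong (ℤ._+ 0ℤ) (ℤP.*-comm b a))
  (≈-trans (+ₚ-cong (≈-refl {b · q}) (*ₚ-∷ʳ p a q))
    (≈-trans (≈-sym (+ₚ-assoc (b · q) (a · p) _))
      (≈-trans (+ₚ-cong (+ₚ-comm (b · q) (a · p)) ≈-refl) (+ₚ-assoc (a · p) (b · q) _))))

*ₚ-comm : ∀ p q → p *ₚ q ≈ q *ₚ p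
*ₚ-comm []      q = ≈-sym (*ₚ-zeroʳ q)
*ₚ-comm (a ∷ p) q =
  ≈-trans (+ₚ-cong ≈-refl (∷-cong refl (*ₚ-comm p q))) (≈-sym (*ₚ-∷ʳ q a p))

*ₚ-congˡ : ∀ {p p′} q → p ≈ p′ → p *ₚ q ≈ p′ *ₚ q
*ₚ-congˡ {p} {p′} q p≈p′ =
  ≈-trans (*ₚ-comm p q) (≈-trans (*ₚ-congʳ q p≈p′) (*ₚ-comm q p′))

*ₚ-cong : ∀ {p p′ q q′} → p ≈ p′ → q ≈ q′ → p *ₚ q ≈ p′ *ₚ q′
*ₚ-cong {p′ = p′} {q = q} p≈p′ q≈q′ = ≈-trans (*ₚ-congˡ q p≈p′) (*ₚ-congʳ p′ q≈q′)

*ₚ-distribˡ-+ₚ : ∀ p q r → p *ₚ (q +ₚ r) ≈ p *ₚ q +ₚ p *ₚ r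
*ₚ-distribˡ-+ₚ []      q r = ≈-refl
*ₚ-distribˡ-+ₚ (a ∷ p) q r =
  ≈-trans (+ₚ-cong (·-distrib-+ₚ a q r) (∷-cong (sym (ℤP.+-identityʳ 0ℤ)) (*ₚ-distribˡ-+ₚ p q r)))
    (+ₚ-interchange (a · q) (a · r) _ _)

*ₚ-distribʳ-+ₚ : ∀ p q r → (q +ₚ r) *ₚ p ≈ q *ₚ p +ₚ r *ₚ p
*ₚ-distribʳ-+ₚ p q r =
  ≈-trans (*ₚ-comm (q +ₚ r) p)
    (≈-trans (*ₚ-distribˡ-+ₚ p q r) (+ₚ-cong (*ₚ-comm p q) (*ₚ-comm p r)))

·-*ₚ : ∀ a q r → (a · q) *ₚ r ≈ a · (q *ₚ r)
·-*ₚ a []      r = ≈-refl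
·-*ₚ a (b ∷ q) r =
  ≈-trans (+ₚ-cong (≈-sym (·-assoc a b r)) (∷-cong (sym (ℤP.*-zeroʳ a)) (·-*ₚ a q r)))
    (≈-sym (·-distrib-+ₚ a (b · r) (0ℤ ∷ (q *ₚ r))))

*ₚ-assoc : ∀ p q r → (p *ₚ q) *ₚ r ≈ p *ₚ (q *ₚ r)
*ₚ-assoc []      q r = ≈-refl
*ₚ-assoc (a ∷ p) q r =
  ≈-trans (*ₚ-distribʳ-+ₚ r (a · q) (0ℤ ∷ (p *ₚ q)))
    (+ₚ-cong (·-*ₚ a q r)
      (≈-trans (+ₚ-cong (·-zeroˡ r) ≈-refl) (∷-cong refl (*ₚ-assoc p q r))))

*ₚ-identityˡ : ∀ p → C 1ℤ *ₚ p ≈ p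
*ₚ-identityˡ p =
  ≈-trans (+ₚ-cong (·-identityˡ p) (∷-zero refl ≈-refl)) (+ₚ-identityʳ p)

*ₚ-identityʳ : ∀ p → p *ₚ C 1ℤ ≈ p
*ₚ-identityʳ p = ≈-trans (*ₚ-comm p (C 1ℤ)) (*ₚ-identityˡ p)

ℤ[X]-isCommutativeRing : IsCommutativeRing _≈_ _+ₚ_ _*ₚ_ -ₚ_ [] (C 1ℤ)
ℤ[X]-isCommutativeRing = record
  { isRing = record
    { +-isAbelianGroup = record
      { isGroup = record
        { isMonoid = record
          { isSemigroup = record
            { isMagma = record
              { isEquivalence = record { refl = ≈-refl ; sym = ≈-sym ; trans = ≈-trans }
              ; ∙-cong = +ₚ-cong }
            ; assoc = +ₚ-assoc }
          ; identity = +ₚ-identityˡ , +ₚ-identityʳ }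
        ; inverse = -ₚ-inverseˡ , -ₚ-inverseʳ
        ; ⁻¹-cong = -ₚ-cong }
      ; comm = +ₚ-comm }
    ; *-cong = *ₚ-cong
    ; *-assoc = *ₚ-assoc
    ; *-identity = *ₚ-identityˡ , *ₚ-identityʳ
    ; distrib = *ₚ-distribˡ-+ₚ , *ₚ-distribʳ-+ₚ }
  ; *-comm = *ₚ-comm }

ℤ[X] : CommutativeRing _ _
ℤ[X] = record { isCommutativeRing = ℤ[X]-isCommutativeRing }

C-* : ∀ a b → C (a ℤ.* b) ≈ C a *ₚ C b
C-* a b = ∷-cong (sym (ℤP.+-identityʳ _)) ≈-refl

C-homomorphism : CommutativeRing.rawRing ℤP.+-*-commutativeRing
                   -Raw-AlmostCommutative⟶ fromCommutativeRing ℤ[X]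
C-homomorphism = record
  { ⟦_⟧ = C ; +-homo = λ _ _ → ≈-refl ; *-homo = C-* ; -‿homo = λ _ → ≈-refl
  ; 0-homo = ∷-zero refl ≈-refl ; 1-homo = ≈-refl }

C-≟ : ∀ a b → Maybe (C a ≈ C b)
C-≟ a b = Maybe.map ≡⇒≈ (Maybe.map (cong C) (dec⇒maybe (a ℤ.≟ b)))

open Algebra.Solver.Ring (CommutativeRing.rawRing ℤP.+-*-commutativeRing)
  (fromCommutativeRing ℤ[X]) C-homomorphism C-≟
  using (solve; _:=_; _:+_; _:*_; _:-_; con)

-- Determinants

module ≈-Reasoning = Relation.Binary.Reasoning.Setoid (CommutativeRing.setoid ℤ[X])

open import Algebra.Properties.CommutativeMonoid.Sum (CommutativeRing.+-commutativeMonoid ℤ[X])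
  using (sum; sum-cong-≋; sum-replicate-zero; ∑-distrib-+; sum-remove)

sum-zero : ∀ {n} (F : Vector Poly n) → (∀ i → F i ≈ []) → sum F ≈ []
sum-zero {n} F F≈0 = ≈-trans (sum-cong-≋ F≈0) (sum-replicate-zero n)

sum-single : ∀ {n} (F : Vector Poly (suc n)) r → (∀ i → i ≢ r → F i ≈ []) → sum F ≈ F r
sum-single F r F≈0 =
  ≈-trans (sum-remove {i = r} F)
    (≈-trans (+ₚ-cong ≈-refl (sum-zero _ λ i → F≈0 (punchIn r i) (punchInᵢ≢i r i)))
      (+ₚ-identityʳ (F r)))

sumₚ-map-tabulate : ∀ {A : Set} {k} (h : Fin k → A) (F : A → Poly) →
                    sumₚ (map F (tabulate h)) ≡ sum (λ i → F (h i))
sumₚ-map-tabulate {k = zero}  h F = refl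
sumₚ-map-tabulate {k = suc k} h F = cong (F (h zero) +ₚ_) (sumₚ-map-tabulate (λ i → h (suc i)) F)

minor : ∀ {n} → Matrix Poly (suc n) → Fin (suc n) → Matrix Poly n
minor M i a b = M (punchIn i a) (suc b)

laplaceTerm : ∀ {n} → Matrix Poly (suc n) → Fin (suc n) → Poly
laplaceTerm {n} M i = sign (toℕ i) *ₚ M i zero *ₚ det n (minor M i)

det-expand : ∀ n M → det (suc n) M ≈ sum (laplaceTerm M)
det-expand n M = ≡⇒≈ (sumₚ-map-tabulate (λ i → i) (laplaceTerm M))

laplaceTerm-zeroEntry : ∀ {n} (M : Matrix Poly (suc n)) i → M i zero ≈ [] → laplaceTerm M i ≈ []
laplaceTerm-zeroEntry {n} M i Mi0≈0 =
  *ₚ-congˡ (det n (minor M i)) (≈-trans (*ₚ-congʳ (sign (toℕ i)) Mi0≈0) (*ₚ-zeroʳ (sign (toℕ i))))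

laplaceTerm-zeroMinor : ∀ {n} (M : Matrix Poly (suc n)) i → det n (minor M i) ≈ [] → laplaceTerm M i ≈ []
laplaceTerm-zeroMinor M i minor≈0 =
  ≈-trans (*ₚ-congʳ (sign (toℕ i) *ₚ M i zero) minor≈0) (*ₚ-zeroʳ (sign (toℕ i) *ₚ M i zero))

det-cong : ∀ n {M N : Matrix Poly n} → (∀ a b → M a b ≈ N a b) → det n M ≈ det n N
det-cong zero    M≈N = ≈-refl
det-cong (suc n) {M} {N} M≈N = begin
  det (suc n) M         ≈⟨ det-expand n M ⟩
  sum (laplaceTerm M)   ≈⟨ sum-cong-≋ (λ i → *ₚ-cong (*ₚ-congʳ (sign (toℕ i)) (M≈N i zero))
                                         (det-cong n (λ a b → M≈N (punchIn i a) (suc b)))) ⟩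
  sum (laplaceTerm N)   ≈⟨ ≈-sym (det-expand n N) ⟩
  det (suc n) N         ∎
  where open ≈-Reasoning

det-zeroRow : ∀ n (M : Matrix Poly n) r → (∀ b → M r b ≈ []) → det n M ≈ []
det-zeroRow (suc n) M r Mr≈0 = ≈-trans (det-expand n M) (sum-zero _ term≈0)
  where
  term≈0 : ∀ i → laplaceTerm M i ≈ []
  term≈0 i with i Fin.≟ r
  ... | yes refl = laplaceTerm-zeroEntry M i (Mr≈0 zero)
  ... | no i≢r   = laplaceTerm-zeroMinor M i (det-zeroRow n (minor M i) (punchOut i≢r)
                     (λ b → subst (λ a → M a (suc b) ≈ []) (sym (punchIn-punchOut i≢r)) (Mr≈0 (suc b))))

det-linear-row : ∀ n r (M M₁ M₂ : Matrix Poly n) →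
                 (∀ b → M r b ≈ M₁ r b +ₚ M₂ r b) →
                 (∀ a → a ≢ r → ∀ b → M a b ≈ M₁ a b) →
                 (∀ a → a ≢ r → ∀ b → M a b ≈ M₂ a b) →
                 det n M ≈ det n M₁ +ₚ det n M₂
det-linear-row (suc n) r M M₁ M₂ row-r rows₁ rows₂ = begin
  det (suc n) M                                ≈⟨ det-expand n M ⟩
  sum (laplaceTerm M)                          ≈⟨ sum-cong-≋ term-split ⟩
  sum (λ i → laplaceTerm M₁ i +ₚ laplaceTerm M₂ i)
                                               ≈⟨ ∑-distrib-+ (laplaceTerm M₁) (laplaceTerm M₂) ⟩
  sum (laplaceTerm M₁) +ₚ sum (laplaceTerm M₂) ≈⟨ ≈-sym (+ₚ-cong (det-expand n M₁) (det-expand n M₂)) ⟩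
  det (suc n) M₁ +ₚ det (suc n) M₂             ∎
  where
  open ≈-Reasoning
  distrib : ∀ s x y d → s *ₚ (x +ₚ y) *ₚ d ≈ s *ₚ x *ₚ d +ₚ s *ₚ y *ₚ d
  distrib = solve 4 (λ s x y d → s :* (x :+ y) :* d := s :* x :* d :+ s :* y :* d) ≈-refl
  distrib′ : ∀ s x y d → s *ₚ x *ₚ (y +ₚ d) ≈ s *ₚ x *ₚ y +ₚ s *ₚ x *ₚ d
  distrib′ = solve 4 (λ s x y d → s :* x :* (y :+ d) := s :* x :* y :+ s :* x :* d) ≈-refl
  term-split : ∀ i → laplaceTerm M i ≈ laplaceTerm M₁ i +ₚ laplaceTerm M₂ i
  term-split i with i Fin.≟ r
  ... | yes refl =
    ≈-trans (*ₚ-cong (*ₚ-congʳ s (row-r zero)) ≈-refl)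
      (≈-trans (distrib s (M₁ i zero) (M₂ i zero) (det n (minor M i)))
        (+ₚ-cong (*ₚ-congʳ (s *ₚ M₁ i zero) (det-cong n λ a b → rows₁ _ (punchInᵢ≢i i a) (suc b)))
                 (*ₚ-congʳ (s *ₚ M₂ i zero) (det-cong n λ a b → rows₂ _ (punchInᵢ≢i i a) (suc b)))))
    where s = sign (toℕ i)
  ... | no i≢r =
    ≈-trans (*ₚ-congʳ (s *ₚ M i zero) minor-split)
      (≈-trans (distrib′ s (M i zero) _ _)
        (+ₚ-cong (*ₚ-congˡ _ (*ₚ-congʳ s (rows₁ i i≢r zero)))
                 (*ₚ-congˡ _ (*ₚ-congʳ s (rows₂ i i≢r zero)))))
    where
    s = sign (toℕ i)
    r′ = punchOut i≢r
    avoids : ∀ a → a ≢ r′ → punchIn i a ≢ r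
    avoids a a≢r′ eq = a≢r′ (punchIn-injective i a r′ (trans eq (sym (punchIn-punchOut i≢r))))
    minor-split : det n (minor M i) ≈ det n (minor M₁ i) +ₚ det n (minor M₂ i)
    minor-split = det-linear-row n r′ (minor M i) (minor M₁ i) (minor M₂ i)
      (λ b → subst (λ a → M a (suc b) ≈ M₁ a (suc b) +ₚ M₂ a (suc b))
                   (sym (punchIn-punchOut i≢r)) (row-r (suc b)))
      (λ a a≢r′ b → rows₁ (punchIn i a) (avoids a a≢r′) (suc b))
      (λ a a≢r′ b → rows₂ (punchIn i a) (avoids a a≢r′) (suc b))

det-sub-row : ∀ n r (M N : Matrix Poly n) → (∀ a → a ≢ r → ∀ b → M a b ≈ N a b) →
              det n M -ₚ det n N ≈ det n (updateAt N r (λ _ b → M r b -ₚ N r b))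
det-sub-row n r M N agree = begin
  det n M -ₚ det n N           ≈⟨ +ₚ-cong split ≈-refl ⟩
  det n N +ₚ det n Z -ₚ det n N ≈⟨ solve 2 (λ d z → d :+ z :- d := z) ≈-refl (det n N) (det n Z) ⟩
  det n Z                      ∎
  where
  open ≈-Reasoning
  Z = updateAt N r (λ _ b → M r b -ₚ N r b)
  split : det n M ≈ det n N +ₚ det n Z
  split = det-linear-row n r M N Z
    (λ b → ≈-trans (solve 2 (λ x y → x := y :+ (x :- y)) ≈-refl (M r b) (N r b))
             (+ₚ-cong ≈-refl (≡⇒≈ (sym (cong (λ row → row b) (updateAt-updates r N))))))
    agree
    (λ a a≢r b → ≈-trans (agree a a≢r b)
                   (≡⇒≈ (sym (cong (λ row → row b) (updateAt-minimal a r N a≢r)))))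

det-single-col₀ : ∀ n (M : Matrix Poly (suc n)) r → (∀ i → i ≢ r → M i zero ≈ []) →
                  det (suc n) M ≈ sign (toℕ r) *ₚ M r zero *ₚ det n (minor M r)
det-single-col₀ n M r col≈0 =
  ≈-trans (det-expand n M) (sum-single _ r λ i i≢r → laplaceTerm-zeroEntry M i (col≈0 i i≢r))

lowerRight : ∀ {n} → Matrix Poly (suc n) → Matrix Poly n
lowerRight M a b = M (suc a) (suc b)

det-single-row₀ : ∀ n (M : Matrix Poly (suc n)) → (∀ b → M zero (suc b) ≈ []) →
                  det (suc n) M ≈ M zero zero *ₚ det n (lowerRight M)
det-single-row₀ zero    M _     =
  ≈-trans (+ₚ-identityʳ (C 1ℤ *ₚ M zero zero *ₚ C 1ℤ)) (*ₚ-congˡ (C 1ℤ) (*ₚ-identityˡ (M zero zero)))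
det-single-row₀ (suc n) M row≈0 = begin
  det (suc (suc n)) M
    ≈⟨ det-expand (suc n) M ⟩
  laplaceTerm M zero +ₚ sum (λ i → laplaceTerm M (suc i))
    ≈⟨ +ₚ-congˡ (laplaceTerm M zero) (sum-zero _ λ i → laplaceTerm-zeroMinor M (suc i)
                                                         (det-zeroRow (suc n) (minor M (suc i)) zero row≈0)) ⟩
  laplaceTerm M zero +ₚ []
    ≈⟨ +ₚ-identityʳ (laplaceTerm M zero) ⟩
  C 1ℤ *ₚ M zero zero *ₚ det (suc n) (lowerRight M)
    ≈⟨ *ₚ-congˡ (det (suc n) (lowerRight M)) (*ₚ-identityˡ (M zero zero)) ⟩
  M zero zero *ₚ det (suc n) (lowerRight M)
    ∎
  where open ≈-Reasoning

det-rows₀₁-col₀ : ∀ n (M : Matrix Poly (suc (suc n))) →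
                  (∀ b → M zero (suc b) ≈ []) → (∀ b → M (suc zero) (suc b) ≈ []) →
                  det (suc (suc n)) M ≈ []
det-rows₀₁-col₀ n M row₀≈0 row₁≈0 = ≈-trans (det-expand (suc n) M) (sum-zero _ term≈0)
  where
  term≈0 : ∀ i → laplaceTerm M i ≈ []
  term≈0 zero    = laplaceTerm-zeroMinor M zero (det-zeroRow (suc n) (minor M zero) zero row₁≈0)
  term≈0 (suc i) = laplaceTerm-zeroMinor M (suc i) (det-zeroRow (suc n) (minor M (suc i)) zero row₀≈0)

det-block₂ : ∀ n (M : Matrix Poly (suc (suc n))) →
             (∀ b → M zero (suc (suc b)) ≈ []) → (∀ b → M (suc zero) (suc (suc b)) ≈ []) →
             det (suc (suc n)) M ≈
               (M zero zero *ₚ M (suc zero) (suc zero) -ₚ M (suc zero) zero *ₚ M zero (suc zero))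
               *ₚ det n (lowerRight (lowerRight M))
det-block₂ n M row₀≈0 row₁≈0 = begin
  det (suc (suc n)) M
    ≈⟨ det-expand (suc n) M ⟩
  C 1ℤ *ₚ a *ₚ det (suc n) (lowerRight M)
    +ₚ (C (ℤ.- 1ℤ) *ₚ c *ₚ det (suc n) (minor M (suc zero)) +ₚ sum (λ i → laplaceTerm M (suc (suc i))))
    ≈⟨ +ₚ-cong (*ₚ-congʳ (C 1ℤ *ₚ a) (det-single-row₀ n (lowerRight M) row₁≈0))
         (+ₚ-cong (*ₚ-congʳ (C (ℤ.- 1ℤ) *ₚ c) (det-single-row₀ n (minor M (suc zero)) row₀≈0))
           (sum-zero _ (rest≈0 M row₀≈0 row₁≈0))) ⟩
  C 1ℤ *ₚ a *ₚ (d *ₚ D) +ₚ (C (ℤ.- 1ℤ) *ₚ c *ₚ (b *ₚ D) +ₚ [])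
    ≈⟨ +ₚ-congˡ (C 1ℤ *ₚ a *ₚ (d *ₚ D)) (+ₚ-identityʳ _) ⟩
  C 1ℤ *ₚ a *ₚ (d *ₚ D) +ₚ C (ℤ.- 1ℤ) *ₚ c *ₚ (b *ₚ D)
    ≈⟨ solve 5 (λ a b c d D → con 1ℤ :* a :* (d :* D) :+ con (ℤ.- 1ℤ) :* c :* (b :* D)
                              := (a :* d :- c :* b) :* D) ≈-refl a b c d D ⟩
  (a *ₚ d -ₚ c *ₚ b) *ₚ D
    ∎
  where
  open ≈-Reasoning
  a = M zero zero
  b = M zero (suc zero)
  c = M (suc zero) zero
  d = M (suc zero) (suc zero)
  D = det n (lowerRight (lowerRight M))
  rest≈0 : ∀ {k} (N : Matrix Poly (suc (suc k))) →
           (∀ b → N zero (suc (suc b)) ≈ []) → (∀ b → N (suc zero) (suc (suc b)) ≈ []) →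
           (i : Fin k) → laplaceTerm N (suc (suc i)) ≈ []
  rest≈0 {suc k} N row₀≈0 row₁≈0 i =
    laplaceTerm-zeroMinor N (suc (suc i)) (det-rows₀₁-col₀ k (minor N (suc (suc i))) row₀≈0 row₁≈0)

-- Layered matrices

-- layered m d c e has levels 0 … m of two twin vertices each: diagonal d k on
-- level k, every entry between levels k and k + 1 equal to c k, and e between the
-- twins of the last level.
module Layered {A : Set} (0# : A) where

  couple : ∀ {N} → A → Fin (suc (suc N)) → A
  couple c zero          = c
  couple c (suc zero)    = c
  couple c (suc (suc _)) = 0#

  prepend : ∀ {N} → A → A → Matrix A (suc (suc N)) → Matrix A (suc (suc (suc (suc N))))
  prepend d c T zero             zero             = d
  prepend d c T zero             (suc zero)       = 0#
  prepend d c T (suc zero)       zero             = 0#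
  prepend d c T (suc zero)       (suc zero)       = d
  prepend d c T zero             (suc (suc b))    = couple c b
  prepend d c T (suc zero)       (suc (suc b))    = couple c b
  prepend d c T (suc (suc a))    zero             = couple c a
  prepend d c T (suc (suc a))    (suc zero)       = couple c a
  prepend d c T (suc (suc a))    (suc (suc b))    = T a b

  pair : A → A → Matrix A 2
  pair d e zero       zero       = d
  pair d e zero       (suc zero) = e
  pair d e (suc zero) zero       = e
  pair d e (suc zero) (suc zero) = d

  layered : ∀ m → (ℕ → A) → (ℕ → A) → A → Matrix A (suc m ℕ.* 2)
  layered zero    d c e = pair (d 0) e
  layered (suc m) d c e = prepend (d 0) (c 0) (layered m (λ k → d (suc k)) (λ k → c (suc k)) e)

  couple-0# : ∀ {N} (b : Fin (suc (suc N))) → couple 0# b ≡ 0#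
  couple-0# zero          = refl
  couple-0# (suc zero)    = refl
  couple-0# (suc (suc b)) = refl

  prepend-cong : ∀ {N} d c {T T′ : Matrix A (suc (suc N))} → (∀ a b → T a b ≡ T′ a b) →
                 ∀ u v → prepend d c T u v ≡ prepend d c T′ u v
  prepend-cong d c T≡T′ zero          zero          = refl
  prepend-cong d c T≡T′ zero          (suc zero)    = refl
  prepend-cong d c T≡T′ (suc zero)    zero          = refl
  prepend-cong d c T≡T′ (suc zero)    (suc zero)    = refl
  prepend-cong d c T≡T′ zero          (suc (suc b)) = refl
  prepend-cong d c T≡T′ (suc zero)    (suc (suc b)) = refl
  prepend-cong d c T≡T′ (suc (suc a)) zero          = refl
  prepend-cong d c T≡T′ (suc (suc a)) (suc zero)    = refl
  prepend-cong d c T≡T′ (suc (suc a)) (suc (suc b)) = T≡T′ a b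

open Layered

record Twins {N} (T : Matrix Poly (suc (suc N))) : Set where
  field
    rows-agree : ∀ b → T (suc zero) (suc (suc b)) ≈ T zero (suc (suc b))
    diagonal   : T (suc zero) (suc zero) ≈ T zero zero
    symmetric  : T zero (suc zero) ≈ T (suc zero) zero

-- Expanding along the first column, the minors that are left differ only in a
-- twin row, so by linearity only the difference of the twin rows of T survives;
-- it vanishes outside the first two columns.
module TwinExpansion {N} (p q : Poly) (T : Matrix Poly (suc (suc N))) (twins : Twins T) where
  open Twins twins
  open ≈-Reasoning

  A : Matrix Poly (suc (suc (suc (suc N))))
  A = prepend [] p q T

  t D D″ : Poly
  t  = T zero zero -ₚ T (suc zero) zero
  D  = det (suc (suc N)) T
  D″ = det N (lowerRight (lowerRight T))

  det-twinBlock : ∀ (K : Matrix Poly (suc (suc N))) →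
                  (∀ b → K zero b ≈ couple [] q b) →
                  (∀ b → K (suc zero) b ≈ T (suc zero) b -ₚ T zero b) →
                  (∀ a b → K (suc (suc a)) (suc (suc b)) ≈ T (suc (suc a)) (suc (suc b))) →
                  det (suc (suc N)) K ≈ C (+ 2) *ₚ q *ₚ t *ₚ D″
  det-twinBlock K row₀ row₁ rest = begin
    det (suc (suc N)) K
      ≈⟨ det-block₂ N K (λ b → row₀ (suc (suc b))) row₁-vanishes ⟩
    (K zero zero *ₚ K (suc zero) (suc zero) -ₚ K (suc zero) zero *ₚ K zero (suc zero))
      *ₚ det N (lowerRight (lowerRight K))
      ≈⟨ *ₚ-cong (+ₚ-cong (*ₚ-cong (row₀ zero) K₁₁) (-ₚ-cong (*ₚ-cong (row₁ zero) (row₀ (suc zero)))))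
                 (det-cong N rest) ⟩
    (q *ₚ (T zero zero -ₚ T (suc zero) zero) -ₚ (T (suc zero) zero -ₚ T zero zero) *ₚ q) *ₚ D″
      ≈⟨ solve 4 (λ q x y D → (q :* (x :- y) :- (y :- x) :* q) :* D := con (+ 2) :* q :* (x :- y) :* D)
               ≈-refl q (T zero zero) (T (suc zero) zero) D″ ⟩
    C (+ 2) *ₚ q *ₚ t *ₚ D″
      ∎
    where
    row₁-vanishes : ∀ b → K (suc zero) (suc (suc b)) ≈ []
    row₁-vanishes b = ≈-trans (row₁ (suc (suc b)))
                        (≈-trans (+ₚ-cong (rows-agree b) ≈-refl) (-ₚ-inverseʳ (T zero (suc (suc b)))))
    K₁₁ : K (suc zero) (suc zero) ≈ T zero zero -ₚ T (suc zero) zero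
    K₁₁ = ≈-trans (row₁ (suc zero)) (+ₚ-cong diagonal (-ₚ-cong symmetric))

  A₀ A₂ A₃ : Matrix Poly (suc (suc (suc N)))
  A₀ = minor A zero
  A₂ = minor A (suc (suc zero))
  A₃ = minor A (suc (suc (suc zero)))

  expand-A : det _ A ≈ p *ₚ det _ A₀ +ₚ q *ₚ (det _ A₂ -ₚ det _ A₃)
  expand-A = begin
    det _ A
      ≈⟨ det-expand _ A ⟩
    sum (laplaceTerm A)
      ≈⟨ +ₚ-congˡ (laplaceTerm A zero) (+ₚ-cong (laplaceTerm-zeroEntry A (suc zero) ≈-refl)
           (+ₚ-congˡ (laplaceTerm A (suc (suc zero))) (+ₚ-congˡ (laplaceTerm A (suc (suc (suc zero))))
             (sum-zero _ λ i → laplaceTerm-zeroEntry A (suc (suc (suc (suc i)))) ≈-refl)))) ⟩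
    C 1ℤ *ₚ p *ₚ det _ A₀ +ₚ (C 1ℤ *ₚ q *ₚ det _ A₂ +ₚ (C (ℤ.- 1ℤ) *ₚ q *ₚ det _ A₃ +ₚ []))
      ≈⟨ +ₚ-congˡ (C 1ℤ *ₚ p *ₚ det _ A₀) (+ₚ-congˡ (C 1ℤ *ₚ q *ₚ det _ A₂) (+ₚ-identityʳ _)) ⟩
    C 1ℤ *ₚ p *ₚ det _ A₀ +ₚ (C 1ℤ *ₚ q *ₚ det _ A₂ +ₚ C (ℤ.- 1ℤ) *ₚ q *ₚ det _ A₃)
      ≈⟨ solve 5 (λ p q x y z → con 1ℤ :* p :* x :+ (con 1ℤ :* q :* y :+ con (ℤ.- 1ℤ) :* q :* z)
                                := p :* x :+ q :* (y :- z)) ≈-refl p q (det _ A₀) (det _ A₂) (det _ A₃) ⟩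
    p *ₚ det _ A₀ +ₚ q *ₚ (det _ A₂ -ₚ det _ A₃)
      ∎

  Z : Matrix Poly (suc (suc (suc N)))
  Z = updateAt A₃ (suc (suc zero)) (λ _ b → A₂ (suc (suc zero)) b -ₚ A₃ (suc (suc zero)) b)

  A₂-A₃ : det _ A₂ -ₚ det _ A₃ ≈ det _ Z
  A₂-A₃ = det-sub-row _ (suc (suc zero)) A₂ A₃ agree
    where
    agree : ∀ a → a ≢ suc (suc zero) → ∀ b → A₂ a b ≈ A₃ a b
    agree zero                _   b = ≈-refl
    agree (suc zero)          _   b = ≈-refl
    agree (suc (suc zero))    a≢2 b = ⊥-elim (a≢2 refl)
    agree (suc (suc (suc a))) _   b = ≈-refl

  expand-Z : det _ Z ≈ C (ℤ.- 1ℤ) *ₚ p *ₚ (C (+ 2) *ₚ q *ₚ t *ₚ D″)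
  expand-Z = ≈-trans (det-single-col₀ _ Z (suc zero) col₀)
               (*ₚ-congʳ (C (ℤ.- 1ℤ) *ₚ p)
                 (det-twinBlock (minor Z (suc zero)) (λ _ → ≈-refl) (λ _ → ≈-refl) (λ _ _ → ≈-refl)))
    where
    col₀ : ∀ i → i ≢ suc zero → Z i zero ≈ []
    col₀ zero                _   = ≈-refl
    col₀ (suc zero)          i≢1 = ⊥-elim (i≢1 refl)
    col₀ (suc (suc zero))    _   = -ₚ-inverseʳ q
    col₀ (suc (suc (suc i))) _   = ≈-refl

  y₁ y₂ V : Matrix Poly (suc (suc N))
  y₁ = minor A₀ (suc zero)
  y₂ = minor A₀ (suc (suc zero))
  V  = updateAt y₂ (suc zero) (λ _ b → y₁ (suc zero) b -ₚ y₂ (suc zero) b)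

  expand-A₀ : det _ A₀ ≈ p *ₚ D -ₚ q *ₚ (det _ y₁ -ₚ det _ y₂)
  expand-A₀ = begin
    det _ A₀
      ≈⟨ det-expand _ A₀ ⟩
    sum (laplaceTerm A₀)
      ≈⟨ +ₚ-congˡ (laplaceTerm A₀ zero) (+ₚ-congˡ (laplaceTerm A₀ (suc zero))
           (+ₚ-congˡ (laplaceTerm A₀ (suc (suc zero)))
             (sum-zero _ λ i → laplaceTerm-zeroEntry A₀ (suc (suc (suc i))) ≈-refl))) ⟩
    C 1ℤ *ₚ p *ₚ D +ₚ (C (ℤ.- 1ℤ) *ₚ q *ₚ det _ y₁ +ₚ (C 1ℤ *ₚ q *ₚ det _ y₂ +ₚ []))
      ≈⟨ +ₚ-congˡ (C 1ℤ *ₚ p *ₚ D) (+ₚ-congˡ (C (ℤ.- 1ℤ) *ₚ q *ₚ det _ y₁) (+ₚ-identityʳ _)) ⟩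
    C 1ℤ *ₚ p *ₚ D +ₚ (C (ℤ.- 1ℤ) *ₚ q *ₚ det _ y₁ +ₚ C 1ℤ *ₚ q *ₚ det _ y₂)
      ≈⟨ solve 5 (λ p q d x y → con 1ℤ :* p :* d :+ (con (ℤ.- 1ℤ) :* q :* x :+ con 1ℤ :* q :* y)
                                := p :* d :- q :* (x :- y)) ≈-refl p q D (det _ y₁) (det _ y₂) ⟩
    p *ₚ D -ₚ q *ₚ (det _ y₁ -ₚ det _ y₂)
      ∎

  y₁-y₂ : det _ y₁ -ₚ det _ y₂ ≈ C (+ 2) *ₚ q *ₚ t *ₚ D″
  y₁-y₂ = ≈-trans (det-sub-row _ (suc zero) y₁ y₂ agree)
                  (det-twinBlock V (λ _ → ≈-refl) (λ _ → ≈-refl) (λ _ _ → ≈-refl))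
    where
    agree : ∀ a → a ≢ suc zero → ∀ b → y₁ a b ≈ y₂ a b
    agree zero          _   b = ≈-refl
    agree (suc zero)    a≢1 b = ⊥-elim (a≢1 refl)
    agree (suc (suc a)) _   b = ≈-refl

  det-prepend : det _ A ≈ p *ₚ (p *ₚ D -ₚ C (+ 4) *ₚ q *ₚ q *ₚ t *ₚ D″)
  det-prepend = begin
    det _ A
      ≈⟨ expand-A ⟩
    p *ₚ det _ A₀ +ₚ q *ₚ (det _ A₂ -ₚ det _ A₃)
      ≈⟨ +ₚ-cong (*ₚ-congʳ p (≈-trans expand-A₀ (+ₚ-cong ≈-refl (-ₚ-cong (*ₚ-congʳ q y₁-y₂)))))
                 (*ₚ-congʳ q (≈-trans A₂-A₃ expand-Z)) ⟩
    p *ₚ (p *ₚ D -ₚ q *ₚ (C (+ 2) *ₚ q *ₚ t *ₚ D″)) +ₚ q *ₚ (C (ℤ.- 1ℤ) *ₚ p *ₚ (C (+ 2) *ₚ q *ₚ t *ₚ D″))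
      ≈⟨ solve 5 (λ p q d t d″ → p :* (p :* d :- q :* (con (+ 2) :* q :* t :* d″))
                                  :+ q :* (con (ℤ.- 1ℤ) :* p :* (con (+ 2) :* q :* t :* d″))
                                 := p :* (p :* d :- con (+ 4) :* q :* q :* t :* d″)) ≈-refl p q D t D″ ⟩
    p *ₚ (p *ₚ D -ₚ C (+ 4) *ₚ q *ₚ q *ₚ t *ₚ D″)
      ∎

open TwinExpansion using (det-prepend)

layered-twins : ∀ m a c e → Twins (layered [] m a c e)
layered-twins zero    a c e = record { rows-agree = λ ()     ; diagonal = ≈-refl ; symmetric = ≈-refl }
layered-twins (suc m) a c e = record { rows-agree = λ _ → ≈-refl ; diagonal = ≈-refl ; symmetric = ≈-refl }

-- Determinant of a layered matrix

infixr 5 _∷ˢ_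
_∷ˢ_ : ∀ {A : Set} → A → (ℕ → A) → ℕ → A
(x ∷ˢ s) zero    = x
(x ∷ˢ s) (suc k) = s k

addAt : ℕ → Poly → (ℕ → Poly) → ℕ → Poly
addAt zero    x a = (a 0 +ₚ x) ∷ˢ (λ k → a (suc k))
addAt (suc m) x a = a 0 ∷ˢ addAt m x (λ k → a (suc k))

addAt-< : ∀ m x a k → k < m → addAt m x a k ≡ a k
addAt-< (suc m) x a zero    _         = refl
addAt-< (suc m) x a (suc k) (s<s k<m) = addAt-< m x (λ k → a (suc k)) k k<m

addAt-self : ∀ m x a → addAt m x a m ≡ a m +ₚ x
addAt-self zero    x a = refl
addAt-self (suc m) x a = addAt-self m x (λ k → a (suc k))

continuant : (ℕ → Poly) → (ℕ → Poly) → ℕ → Poly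
continuant a b zero          = C 1ℤ
continuant a b (suc zero)    = a 0
continuant a b (suc (suc k)) = a (suc k) *ₚ continuant a b (suc k) -ₚ b k *ₚ continuant a b k

continuant-cong : ∀ n {a a′ b b′ : ℕ → Poly} → (∀ k → k < n → a k ≈ a′ k) → (∀ k → b k ≈ b′ k) →
                  continuant a b n ≈ continuant a′ b′ n
continuant-cong zero          a≈ b≈ = ≈-refl
continuant-cong (suc zero)    a≈ b≈ = a≈ 0 z<s
continuant-cong (suc (suc n)) a≈ b≈ =
  +ₚ-cong (*ₚ-cong (a≈ (suc n) (ℕP.n<1+n (suc n))) (continuant-cong (suc n) (λ k k< → a≈ k (ℕP.m<n⇒m<1+n k<)) b≈))
          (-ₚ-cong (*ₚ-cong (b≈ n) (continuant-cong n (λ k k< → a≈ k (ℕP.m<n⇒m<1+n (ℕP.m<n⇒m<1+n k<))) b≈)))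

continuant-unfoldˡ : ∀ k a b →
  continuant a b (suc (suc k)) ≈
    a 0 *ₚ continuant (λ i → a (suc i)) (λ i → b (suc i)) (suc k)
      -ₚ b 0 *ₚ continuant (λ i → a (suc (suc i))) (λ i → b (suc (suc i))) k
continuant-unfoldˡ zero a b =
  solve 3 (λ a₀ a₁ b₀ → a₁ :* a₀ :- b₀ :* con 1ℤ := a₀ :* a₁ :- b₀ :* con 1ℤ) ≈-refl (a 0) (a 1) (b 0)
continuant-unfoldˡ (suc zero) a b =
  solve 5 (λ a₀ a₁ a₂ b₀ b₁ → a₂ :* (a₁ :* a₀ :- b₀ :* con 1ℤ) :- b₁ :* a₀
                              := a₀ :* (a₂ :* a₁ :- b₁ :* con 1ℤ) :- b₀ :* a₂)
    ≈-refl (a 0) (a 1) (a 2) (b 0) (b 1)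
continuant-unfoldˡ (suc (suc k)) a b = begin
  aₖ *ₚ continuant a b (suc (suc (suc k))) -ₚ bₖ *ₚ continuant a b (suc (suc k))
    ≈⟨ +ₚ-cong (*ₚ-congʳ aₖ (continuant-unfoldˡ (suc k) a b)) (-ₚ-cong (*ₚ-congʳ bₖ (continuant-unfoldˡ k a b))) ⟩
  aₖ *ₚ (a 0 *ₚ K′₂ -ₚ b 0 *ₚ K″₁) -ₚ bₖ *ₚ (a 0 *ₚ K′₁ -ₚ b 0 *ₚ K″₀)
    ≈⟨ solve 8 (λ a₀ b₀ aₖ bₖ K′₂ K″₁ K′₁ K″₀ →
                  aₖ :* (a₀ :* K′₂ :- b₀ :* K″₁) :- bₖ :* (a₀ :* K′₁ :- b₀ :* K″₀)
                  := a₀ :* (aₖ :* K′₂ :- bₖ :* K′₁) :- b₀ :* (aₖ :* K″₁ :- bₖ :* K″₀))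
             ≈-refl (a 0) (b 0) aₖ bₖ K′₂ K″₁ K′₁ K″₀ ⟩
  a 0 *ₚ (aₖ *ₚ K′₂ -ₚ bₖ *ₚ K′₁) -ₚ b 0 *ₚ (aₖ *ₚ K″₁ -ₚ bₖ *ₚ K″₀)
    ∎
  where
  open ≈-Reasoning
  aₖ = a (suc (suc (suc k)))
  bₖ = b (suc (suc k))
  K′ = continuant (λ i → a (suc i)) (λ i → b (suc i))
  K″ = continuant (λ i → a (suc (suc i))) (λ i → b (suc (suc i)))
  K′₂ = K′ (suc (suc k))
  K′₁ = K′ (suc k)
  K″₁ = K″ (suc k)
  K″₀ = K″ k

det-layered : ∀ m a c e →
  det (suc m ℕ.* 2) (layered [] m a c e) ≈
    prodₚ (applyUpTo (addAt m (-ₚ e) a) (suc m))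
      *ₚ continuant (addAt m e a) (λ k → C (+ 4) *ₚ c k *ₚ c k) (suc m)
det-layered zero a c e =
  ≈-trans (det-block₂ 0 (pair [] (a 0) e) (λ ()) (λ ()))
    (solve 2 (λ x e → (x :* x :- e :* e) :* con 1ℤ := (x :- e) :* con 1ℤ :* (x :+ e)) ≈-refl (a 0) e)
det-layered (suc zero) a c e = begin
  det 4 (prepend [] (a 0) (c 0) T)
    ≈⟨ det-prepend (a 0) (c 0) T (layered-twins 0 (λ k → a (suc k)) (λ k → c (suc k)) e) ⟩
  a 0 *ₚ (a 0 *ₚ det 2 T -ₚ C (+ 4) *ₚ c 0 *ₚ c 0 *ₚ (a 1 -ₚ e) *ₚ C 1ℤ)
    ≈⟨ *ₚ-congʳ (a 0) (+ₚ-cong (*ₚ-congʳ (a 0) (det-layered zero (λ k → a (suc k)) (λ k → c (suc k)) e)) ≈-refl) ⟩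
  a 0 *ₚ (a 0 *ₚ ((a 1 -ₚ e) *ₚ C 1ℤ *ₚ (a 1 +ₚ e)) -ₚ C (+ 4) *ₚ c 0 *ₚ c 0 *ₚ (a 1 -ₚ e) *ₚ C 1ℤ)
    ≈⟨ solve 4 (λ a₀ a₁ c₀ e →
                  a₀ :* (a₀ :* ((a₁ :- e) :* con 1ℤ :* (a₁ :+ e)) :- con (+ 4) :* c₀ :* c₀ :* (a₁ :- e) :* con 1ℤ)
                  := a₀ :* ((a₁ :- e) :* con 1ℤ) :* ((a₁ :+ e) :* a₀ :- con (+ 4) :* c₀ :* c₀ :* con 1ℤ))
             ≈-refl (a 0) (a 1) (c 0) e ⟩
  a 0 *ₚ ((a 1 -ₚ e) *ₚ C 1ℤ) *ₚ ((a 1 +ₚ e) *ₚ a 0 -ₚ C (+ 4) *ₚ c 0 *ₚ c 0 *ₚ C 1ℤ)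
    ∎
  where
  open ≈-Reasoning
  T = pair [] (a 1) e
det-layered (suc (suc m)) a c e = begin
  det _ (prepend [] (a 0) (c 0) T)
    ≈⟨ det-prepend (a 0) (c 0) T (layered-twins (suc m) (λ k → a (suc k)) (λ k → c (suc k)) e) ⟩
  a 0 *ₚ (a 0 *ₚ det _ T -ₚ C (+ 4) *ₚ c 0 *ₚ c 0 *ₚ (a 1 -ₚ []) *ₚ det _ T″)
    ≈⟨ *ₚ-congʳ (a 0) (+ₚ-cong (*ₚ-congʳ (a 0) (det-layered (suc m) (λ k → a (suc k)) (λ k → c (suc k)) e))
                               (-ₚ-cong (*ₚ-cong (*ₚ-congʳ (C (+ 4) *ₚ c 0 *ₚ c 0) (+ₚ-identityʳ (a 1)))
                                                 (det-layered m (λ k → a (suc (suc k))) (λ k → c (suc (suc k))) e)))) ⟩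
  a 0 *ₚ (a 0 *ₚ (a 1 *ₚ P″ *ₚ K′) -ₚ C (+ 4) *ₚ c 0 *ₚ c 0 *ₚ a 1 *ₚ (P″ *ₚ K″))
    ≈⟨ solve 6 (λ a₀ a₁ c₀ P″ K′ K″ →
                  a₀ :* (a₀ :* (a₁ :* P″ :* K′) :- con (+ 4) :* c₀ :* c₀ :* a₁ :* (P″ :* K″))
                  := a₀ :* (a₁ :* P″) :* (a₀ :* K′ :- con (+ 4) :* c₀ :* c₀ :* K″))
             ≈-refl (a 0) (a 1) (c 0) P″ K′ K″ ⟩
  a 0 *ₚ (a 1 *ₚ P″) *ₚ (a 0 *ₚ K′ -ₚ C (+ 4) *ₚ c 0 *ₚ c 0 *ₚ K″)
    ≈⟨ *ₚ-congʳ (a 0 *ₚ (a 1 *ₚ P″)) (≈-sym (continuant-unfoldˡ (suc m) (addAt (suc (suc m)) e a) b)) ⟩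
  prodₚ (applyUpTo (addAt (suc (suc m)) (-ₚ e) a) (suc (suc (suc m))))
    *ₚ continuant (addAt (suc (suc m)) e a) b (suc (suc (suc m)))
    ∎
  where
  open ≈-Reasoning
  T  = layered [] (suc m) (λ k → a (suc k)) (λ k → c (suc k)) e
  T″ = layered [] m (λ k → a (suc (suc k))) (λ k → c (suc (suc k))) e
  b  = λ k → C (+ 4) *ₚ c k *ₚ c k
  P″ = prodₚ (applyUpTo (addAt m (-ₚ e) (λ k → a (suc (suc k)))) (suc m))
  K′ = continuant (addAt (suc m) e (λ k → a (suc k))) (λ k → b (suc k)) (suc (suc m))
  K″ = continuant (addAt m e (λ k → a (suc (suc k)))) (λ k → b (suc (suc k))) (suc m)

couple-map : ∀ {A B : Set} {0A : A} {0B : B} (f : A → B) → f 0A ≡ 0B →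
             ∀ {N} c (b : Fin (suc (suc N))) → f (couple 0A c b) ≡ couple 0B (f c) b
couple-map f f0 c zero          = refl
couple-map f f0 c (suc zero)    = refl
couple-map f f0 c (suc (suc b)) = f0

layered-map : ∀ {A B : Set} {0A : A} {0B : B} (f : A → B) → f 0A ≡ 0B →
              ∀ m d c e u v →
              f (layered 0A m d c e u v) ≡ layered 0B m (λ k → f (d k)) (λ k → f (c k)) (f e) u v
layered-map f f0 zero    d c e zero          zero          = refl
layered-map f f0 zero    d c e zero          (suc zero)    = refl
layered-map f f0 zero    d c e (suc zero)    zero          = refl
layered-map f f0 zero    d c e (suc zero)    (suc zero)    = refl
layered-map f f0 (suc m) d c e zero          zero          = refl
layered-map f f0 (suc m) d c e zero          (suc zero)    = f0
layered-map f f0 (suc m) d c e (suc zero)    zero          = f0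
layered-map f f0 (suc m) d c e (suc zero)    (suc zero)    = refl
layered-map f f0 (suc m) d c e zero          (suc (suc b)) = couple-map f f0 (c 0) b
layered-map f f0 (suc m) d c e (suc zero)    (suc (suc b)) = couple-map f f0 (c 0) b
layered-map f f0 (suc m) d c e (suc (suc a)) zero          = couple-map f f0 (c 0) a
layered-map f f0 (suc m) d c e (suc (suc a)) (suc zero)    = couple-map f f0 (c 0) a
layered-map f f0 (suc m) d c e (suc (suc a)) (suc (suc b)) =
  layered-map f f0 m (λ k → d (suc k)) (λ k → c (suc k)) e a b

diag₀ : ∀ {N} → ℤ → Matrix ℤ (suc (suc N))
diag₀ x zero       zero       = x
diag₀ x (suc zero) (suc zero) = x
diag₀ x _          _          = 0ℤ

diag₀-+-layered : ∀ x m d c e u v →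
                  diag₀ x u v ℤ.+ layered 0ℤ m d c e u v ≡
                  layered 0ℤ m ((x ℤ.+ d 0) ∷ˢ (λ k → d (suc k))) c e u v
diag₀-+-layered x zero    d c e zero          zero          = refl
diag₀-+-layered x zero    d c e zero          (suc zero)    = ℤP.+-identityˡ e
diag₀-+-layered x zero    d c e (suc zero)    zero          = ℤP.+-identityˡ e
diag₀-+-layered x zero    d c e (suc zero)    (suc zero)    = refl
diag₀-+-layered x (suc m) d c e zero          zero          = refl
diag₀-+-layered x (suc m) d c e zero          (suc zero)    = refl
diag₀-+-layered x (suc m) d c e (suc zero)    zero          = refl
diag₀-+-layered x (suc m) d c e (suc zero)    (suc zero)    = refl
diag₀-+-layered x (suc m) d c e zero          (suc (suc b)) = ℤP.+-identityˡ _
diag₀-+-layered x (suc m) d c e (suc zero)    (suc (suc b)) = ℤP.+-identityˡ _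
diag₀-+-layered x (suc m) d c e (suc (suc a)) zero          = ℤP.+-identityˡ _
diag₀-+-layered x (suc m) d c e (suc (suc a)) (suc zero)    = ℤP.+-identityˡ _
diag₀-+-layered x (suc m) d c e (suc (suc a)) (suc (suc b)) = ℤP.+-identityˡ _

couple-+ : ∀ {N} c c′ (b : Fin (suc (suc N))) → couple 0ℤ c b ℤ.+ couple 0ℤ c′ b ≡ couple 0ℤ (c ℤ.+ c′) b
couple-+ c c′ zero          = refl
couple-+ c c′ (suc zero)    = refl
couple-+ c c′ (suc (suc b)) = refl

prepend-+ : ∀ {N} d c d′ c′ (T T′ : Matrix ℤ (suc (suc N))) u v →
            prepend 0ℤ d c T u v ℤ.+ prepend 0ℤ d′ c′ T′ u v ≡
            prepend 0ℤ (d ℤ.+ d′) (c ℤ.+ c′) (λ a b → T a b ℤ.+ T′ a b) u v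
prepend-+ d c d′ c′ T T′ zero          zero          = refl
prepend-+ d c d′ c′ T T′ zero          (suc zero)    = refl
prepend-+ d c d′ c′ T T′ (suc zero)    zero          = refl
prepend-+ d c d′ c′ T T′ (suc zero)    (suc zero)    = refl
prepend-+ d c d′ c′ T T′ zero          (suc (suc b)) = couple-+ c c′ b
prepend-+ d c d′ c′ T T′ (suc zero)    (suc (suc b)) = couple-+ c c′ b
prepend-+ d c d′ c′ T T′ (suc (suc a)) zero          = couple-+ c c′ a
prepend-+ d c d′ c′ T T′ (suc (suc a)) (suc zero)    = couple-+ c c′ a
prepend-+ d c d′ c′ T T′ (suc (suc a)) (suc (suc b)) = refl

-- The Laplacian of 𝔾

open Edge

degreeTerm : ∀ {V} → Fin V → Edge V → ℤ
degreeTerm u e = if (end₁ e == u) ∨ (end₂ e == u) then + conductance e else 0ℤ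

adjacencyTerm : ∀ {V} → Fin V → Fin V → Edge V → ℤ
adjacencyTerm u v e =
  if ((end₁ e == u) ∧ (end₂ e == v)) ∨ ((end₁ e == v) ∧ (end₂ e == u)) then + conductance e else 0ℤ

-- laplacian G unfolds to laplacianOf (WMultigraph.edges G).
laplacianOf : ∀ {V} → List (Edge V) → Matrix ℤ V
laplacianOf Es u v =
  if u == v then sumℤ (map (degreeTerm u) Es) else ℤ.- sumℤ (map (adjacencyTerm u v) Es)

sumℤ-++ : ∀ xs ys → sumℤ (xs ++ ys) ≡ sumℤ xs ℤ.+ sumℤ ys
sumℤ-++ []       ys = sym (ℤP.+-identityˡ _)
sumℤ-++ (x ∷ xs) ys = trans (cong (λ s → x ℤ.+ s) (sumℤ-++ xs ys)) (sym (ℤP.+-assoc x _ _))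

sumℤ-zero : ∀ {A : Set} (f : A → ℤ) → (∀ x → f x ≡ 0ℤ) → ∀ xs → sumℤ (map f xs) ≡ 0ℤ
sumℤ-zero f f≡0 []       = refl
sumℤ-zero f f≡0 (x ∷ xs) = cong₂ ℤ._+_ (f≡0 x) (sumℤ-zero f f≡0 xs)

sumℤ-double : ∀ {A : Set} (f g : A → ℤ) → (∀ x → f x ≡ + 2 ℤ.* g x) →
              ∀ xs → sumℤ (map f xs) ≡ + 2 ℤ.* sumℤ (map g xs)
sumℤ-double f g f≡2g []       = refl
sumℤ-double f g f≡2g (x ∷ xs) =
  trans (cong₂ ℤ._+_ (f≡2g x) (sumℤ-double f g f≡2g xs)) (sym (ℤP.*-distribˡ-+ (+ 2) (g x) _))

if-same : ∀ {A : Set} b (x : A) → (if b then x else x) ≡ x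
if-same true  x = refl
if-same false x = refl

laplacianOf-++ : ∀ {V} (Es Fs : List (Edge V)) u v →
                 laplacianOf (Es ++ Fs) u v ≡ laplacianOf Es u v ℤ.+ laplacianOf Fs u v
laplacianOf-++ Es Fs u v with u == v
... | true  = trans (cong sumℤ (ListP.map-++ (degreeTerm u) Es Fs)) (sumℤ-++ (map (degreeTerm u) Es) _)
... | false = trans (cong (λ xs → ℤ.- sumℤ xs) (ListP.map-++ (adjacencyTerm u v) Es Fs))
                (trans (cong ℤ.-_ (sumℤ-++ (map (adjacencyTerm u v) Es) _))
                  (ℤP.neg-distrib-+ (sumℤ (map (adjacencyTerm u v) Es)) _))

shiftEdge : ∀ {V} → Edge V → Edge (suc (suc V))
shiftEdge (edge x y c) = edge (suc (suc x)) (suc (suc y)) (2 ℕ.* c)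

data Top {N} : Fin (suc (suc N)) → Set where
  top₀ : Top zero
  top₁ : Top (suc zero)

shifted≢top : ∀ {N} {u : Fin (suc (suc N))} → Top u → ∀ x → (suc (suc x) == u) ≡ false
shifted≢top top₀ x = refl
shifted≢top top₁ x = refl

degreeTerm-shift-top : ∀ {N} {u : Fin (suc (suc N))} → Top u → ∀ e → degreeTerm u (shiftEdge e) ≡ 0ℤ
degreeTerm-shift-top t (edge x y c) rewrite shifted≢top t x | shifted≢top t y = refl

adjacencyTerm-shift-topRow : ∀ {N} {u : Fin (suc (suc N))} → Top u → ∀ v e →
                             adjacencyTerm u v (shiftEdge e) ≡ 0ℤ
adjacencyTerm-shift-topRow t v (edge x y c)
  rewrite shifted≢top t x | shifted≢top t y | ∧-zeroʳ (suc (suc x) == v) = refl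

adjacencyTerm-shift-topCol : ∀ {N} {v : Fin (suc (suc N))} → Top v → ∀ u e →
                             adjacencyTerm u v (shiftEdge e) ≡ 0ℤ
adjacencyTerm-shift-topCol t u (edge x y c)
  rewrite shifted≢top t x | shifted≢top t y | ∧-zeroʳ (suc (suc x) == u) = refl

==-suc : ∀ {V} (a b : Fin V) → (suc a == suc b) ≡ (a == b)
==-suc a b with a Fin.≟ b
... | yes _ = refl
... | no  _ = refl

==-suc-suc : ∀ {V} (a b : Fin V) → (suc (suc a) == suc (suc b)) ≡ (a == b)
==-suc-suc a b = trans (==-suc (suc a) (suc b)) (==-suc a b)

if-double : ∀ b c → (if b then + (2 ℕ.* c) else 0ℤ) ≡ + 2 ℤ.* (if b then + c else 0ℤ)
if-double true  c = ℤP.pos-* 2 c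
if-double false c = refl

degreeTerm-shift : ∀ {V} (a : Fin V) e → degreeTerm (suc (suc a)) (shiftEdge e) ≡ + 2 ℤ.* degreeTerm a e
degreeTerm-shift a (edge x y c) rewrite ==-suc-suc x a | ==-suc-suc y a = if-double ((x == a) ∨ (y == a)) c

adjacencyTerm-shift : ∀ {V} (a b : Fin V) e →
                      adjacencyTerm (suc (suc a)) (suc (suc b)) (shiftEdge e) ≡ + 2 ℤ.* adjacencyTerm a b e
adjacencyTerm-shift a b (edge x y c)
  rewrite ==-suc-suc x a | ==-suc-suc y a | ==-suc-suc x b | ==-suc-suc y b =
  if-double (((x == a) ∧ (y == b)) ∨ ((x == b) ∧ (y == a))) c

sumℤ-shift-zero : ∀ {V} (f : Edge (suc (suc V)) → ℤ) → (∀ e → f (shiftEdge e) ≡ 0ℤ) →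
                  ∀ Es → sumℤ (map f (map shiftEdge Es)) ≡ 0ℤ
sumℤ-shift-zero f f≡0 Es = trans (cong sumℤ (sym (ListP.map-∘ Es))) (sumℤ-zero _ f≡0 Es)

sumℤ-shift-double : ∀ {V} (f : Edge (suc (suc V)) → ℤ) (g : Edge V → ℤ) →
                    (∀ e → f (shiftEdge e) ≡ + 2 ℤ.* g e) →
                    ∀ Es → sumℤ (map f (map shiftEdge Es)) ≡ + 2 ℤ.* sumℤ (map g Es)
sumℤ-shift-double f g f≡2g Es = trans (cong sumℤ (sym (ListP.map-∘ Es))) (sumℤ-double _ g f≡2g Es)

laplacianOf-shift-topRow : ∀ {N} (Es : List (Edge N)) {u} → Top u → ∀ v →
                           laplacianOf (map shiftEdge Es) u v ≡ 0ℤ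
laplacianOf-shift-topRow Es {u} t v =
  trans (cong₂ (if u == v then_else_)
               (sumℤ-shift-zero (degreeTerm u) (degreeTerm-shift-top t) Es)
               (cong ℤ.-_ (sumℤ-shift-zero (adjacencyTerm u v) (adjacencyTerm-shift-topRow t v) Es)))
        (if-same (u == v) 0ℤ)

laplacianOf-shift-topCol : ∀ {N} (Es : List (Edge N)) {v} → Top v → ∀ a →
                           laplacianOf (map shiftEdge Es) (suc (suc a)) v ≡ 0ℤ
laplacianOf-shift-topCol Es top₀ a =
  cong ℤ.-_ (sumℤ-shift-zero _ (adjacencyTerm-shift-topCol top₀ (suc (suc a))) Es)
laplacianOf-shift-topCol Es top₁ a =
  cong ℤ.-_ (sumℤ-shift-zero _ (adjacencyTerm-shift-topCol top₁ (suc (suc a))) Es)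

laplacianOf-shift-inner : ∀ {N} (Es : List (Edge N)) a b →
                          laplacianOf (map shiftEdge Es) (suc (suc a)) (suc (suc b)) ≡ + 2 ℤ.* laplacianOf Es a b
laplacianOf-shift-inner Es a b rewrite ==-suc-suc a b with a == b
... | true  = sumℤ-shift-double _ (degreeTerm a) (degreeTerm-shift a) Es
... | false = trans (cong ℤ.-_ (sumℤ-shift-double _ (adjacencyTerm a b) (adjacencyTerm-shift a b) Es))
                    (ℤP.neg-distribʳ-* (+ 2) (sumℤ (map (adjacencyTerm a b) Es)))

laplacianOf-shift : ∀ {N} (Es : List (Edge (suc (suc N)))) u v →
                    laplacianOf (map shiftEdge Es) u v ≡ prepend 0ℤ 0ℤ 0ℤ (λ a b → + 2 ℤ.* laplacianOf Es a b) u v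
laplacianOf-shift Es zero          zero          = laplacianOf-shift-topRow Es top₀ zero
laplacianOf-shift Es zero          (suc zero)    = laplacianOf-shift-topRow Es top₀ (suc zero)
laplacianOf-shift Es (suc zero)    zero          = laplacianOf-shift-topRow Es top₁ zero
laplacianOf-shift Es (suc zero)    (suc zero)    = laplacianOf-shift-topRow Es top₁ (suc zero)
laplacianOf-shift Es zero          (suc (suc b)) =
  trans (laplacianOf-shift-topRow Es top₀ (suc (suc b))) (sym (couple-0# 0ℤ b))
laplacianOf-shift Es (suc zero)    (suc (suc b)) =
  trans (laplacianOf-shift-topRow Es top₁ (suc (suc b))) (sym (couple-0# 0ℤ b))
laplacianOf-shift Es (suc (suc a)) zero          = trans (laplacianOf-shift-topCol Es top₀ a) (sym (couple-0# 0ℤ a))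
laplacianOf-shift Es (suc (suc a)) (suc zero)    = trans (laplacianOf-shift-topCol Es top₁ a) (sym (couple-0# 0ℤ a))
laplacianOf-shift Es (suc (suc a)) (suc (suc b)) = laplacianOf-shift-inner Es a b

levelEdges : ∀ m → Fin m → List (Edge (suc m ℕ.* 2))
levelEdges m k =
  let c = 2 ℕ.^ suc (toℕ k) in
  edge (vtx (inject₁ k) zero)       (vtx (suc k) zero)       c ∷
  edge (vtx (inject₁ k) zero)       (vtx (suc k) (suc zero)) c ∷
  edge (vtx (inject₁ k) (suc zero)) (vtx (suc k) zero)       c ∷
  edge (vtx (inject₁ k) (suc zero)) (vtx (suc k) (suc zero)) c ∷ []

finalEdges : ∀ m → List (Edge (suc m ℕ.* 2))
finalEdges m = edge (vtx (fromℕ m) zero) (vtx (fromℕ m) (suc zero)) (2 ℕ.^ m)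
             ∷ edge (vtx (fromℕ m) zero) (vtx (fromℕ m) (suc zero)) (2 ℕ.^ m) ∷ []

edges-𝔾-suc : ∀ m → WMultigraph.edges (𝔾 (suc m)) ≡
              levelEdges (suc m) zero ++ map shiftEdge (WMultigraph.edges (𝔾 m))
edges-𝔾-suc m = begin
  (levelEdges (suc m) zero ++ concatMap (levelEdges (suc m)) (tabulate suc)) ++ finalEdges (suc m)
    ≡⟨ ListP.++-assoc (levelEdges (suc m) zero) _ (finalEdges (suc m)) ⟩
  levelEdges (suc m) zero ++ (concatMap (levelEdges (suc m)) (tabulate suc) ++ map shiftEdge (finalEdges m))
    ≡⟨ cong (λ Es → levelEdges (suc m) zero ++ (Es ++ map shiftEdge (finalEdges m))) higherLevels ⟩
  levelEdges (suc m) zero ++ (map shiftEdge (concatMap (levelEdges m) (allFin m)) ++ map shiftEdge (finalEdges m))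
    ≡⟨ cong (levelEdges (suc m) zero ++_) (sym (ListP.map-++ shiftEdge _ (finalEdges m))) ⟩
  levelEdges (suc m) zero ++ map shiftEdge (concatMap (levelEdges m) (allFin m) ++ finalEdges m)
    ∎
  where
  open ≡-Reasoning
  higherLevels : concatMap (levelEdges (suc m)) (tabulate suc) ≡ map shiftEdge (concatMap (levelEdges m) (allFin m))
  higherLevels = begin
    concat (map (levelEdges (suc m)) (tabulate suc))
      ≡⟨ cong concat (ListP.map-tabulate suc (levelEdges (suc m))) ⟩
    concat (tabulate (λ k → map shiftEdge (levelEdges m k)))
      ≡⟨ cong concat (sym (ListP.map-tabulate (λ k → k) (λ k → map shiftEdge (levelEdges m k)))) ⟩
    concatMap (λ k → map shiftEdge (levelEdges m k)) (allFin m)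
      ≡⟨ sym (ListP.map-concatMap shiftEdge (levelEdges m) (allFin m)) ⟩
    map shiftEdge (concatMap (levelEdges m) (allFin m))
      ∎

laplacianOf-level₀ : ∀ m u v → laplacianOf (levelEdges (suc m) zero) u v ≡
                     prepend 0ℤ (+ 4) (ℤ.- + 2) (diag₀ (+ 4)) u v
laplacianOf-level₀ m zero                      zero                      = refl
laplacianOf-level₀ m zero                      (suc zero)                = refl
laplacianOf-level₀ m zero                      (suc (suc zero))          = refl
laplacianOf-level₀ m zero                      (suc (suc (suc zero)))    = refl
laplacianOf-level₀ m zero                      (suc (suc (suc (suc b)))) = refl
laplacianOf-level₀ m (suc zero)                zero                      = refl
laplacianOf-level₀ m (suc zero)                (suc zero)                = refl
laplacianOf-level₀ m (suc zero)                (suc (suc zero))          = refl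
laplacianOf-level₀ m (suc zero)                (suc (suc (suc zero)))    = refl
laplacianOf-level₀ m (suc zero)                (suc (suc (suc (suc b)))) = refl
laplacianOf-level₀ m (suc (suc zero))          zero                      = refl
laplacianOf-level₀ m (suc (suc zero))          (suc zero)                = refl
laplacianOf-level₀ m (suc (suc zero))          (suc (suc zero))          = refl
laplacianOf-level₀ m (suc (suc zero))          (suc (suc (suc zero)))    = refl
laplacianOf-level₀ m (suc (suc zero))          (suc (suc (suc (suc b)))) = refl
laplacianOf-level₀ m (suc (suc (suc zero)))    zero                      = refl
laplacianOf-level₀ m (suc (suc (suc zero)))    (suc zero)                = refl
laplacianOf-level₀ m (suc (suc (suc zero)))    (suc (suc zero))          = refl
laplacianOf-level₀ m (suc (suc (suc zero)))    (suc (suc (suc zero)))    = refl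
laplacianOf-level₀ m (suc (suc (suc zero)))    (suc (suc (suc (suc b)))) = refl
laplacianOf-level₀ m (suc (suc (suc (suc a)))) zero                      = refl
laplacianOf-level₀ m (suc (suc (suc (suc a)))) (suc zero)                = refl
laplacianOf-level₀ m (suc (suc (suc (suc a)))) (suc (suc zero))          = refl
laplacianOf-level₀ m (suc (suc (suc (suc a)))) (suc (suc (suc zero)))    = refl
laplacianOf-level₀ m (suc (suc (suc (suc a)))) (suc (suc (suc (suc b)))) =
  if-same (suc (suc (suc (suc a))) == suc (suc (suc (suc b)))) 0ℤ

-- δ m k is the degree of the level-k vertices of 𝔾 m and κ k the Laplacian entry
-- between levels k and k + 1 (κ m also joins the last twins of 𝔾 m); both follow
-- the recursion of laplacian-𝔾-suc, so that the layered form unfolds definitionally.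
δ : ℕ → ℕ → ℤ
δ zero    = λ _ → + 2
δ (suc m) = + 4 ∷ˢ (+ 4 ℤ.+ + 2 ℤ.* δ m 0) ∷ˢ (λ k → + 2 ℤ.* δ m (suc k))

κ : ℕ → ℤ
κ zero    = ℤ.- + 2
κ (suc k) = + 2 ℤ.* κ k

laplacian-𝔾-suc : ∀ m u v →
  laplacian (𝔾 (suc m)) u v ≡
    prepend 0ℤ (+ 4) (ℤ.- + 2) (λ a b → diag₀ (+ 4) a b ℤ.+ + 2 ℤ.* laplacian (𝔾 m) a b) u v
laplacian-𝔾-suc m u v = begin
  laplacianOf (WMultigraph.edges (𝔾 (suc m))) u v
    ≡⟨ cong (λ Fs → laplacianOf Fs u v) (edges-𝔾-suc m) ⟩
  laplacianOf (E₀ ++ map shiftEdge Es) u v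
    ≡⟨ laplacianOf-++ E₀ (map shiftEdge Es) u v ⟩
  laplacianOf E₀ u v ℤ.+ laplacianOf (map shiftEdge Es) u v
    ≡⟨ cong₂ ℤ._+_ (laplacianOf-level₀ m u v) (laplacianOf-shift Es u v) ⟩
  prepend 0ℤ (+ 4) (ℤ.- + 2) (diag₀ (+ 4)) u v ℤ.+ prepend 0ℤ 0ℤ 0ℤ (λ a b → + 2 ℤ.* laplacianOf Es a b) u v
    ≡⟨ prepend-+ (+ 4) (ℤ.- + 2) 0ℤ 0ℤ (diag₀ (+ 4)) (λ a b → + 2 ℤ.* laplacianOf Es a b) u v ⟩
  prepend 0ℤ (+ 4) (ℤ.- + 2) (λ a b → diag₀ (+ 4) a b ℤ.+ + 2 ℤ.* laplacian (𝔾 m) a b) u v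
    ∎
  where
  open ≡-Reasoning
  E₀ = levelEdges (suc m) zero
  Es = WMultigraph.edges (𝔾 m)

laplacian-𝔾 : ∀ m u v → laplacian (𝔾 m) u v ≡ layered 0ℤ m (δ m) κ (κ m) u v
laplacian-𝔾 zero    zero       zero       = refl
laplacian-𝔾 zero    zero       (suc zero) = refl
laplacian-𝔾 zero    (suc zero) zero       = refl
laplacian-𝔾 zero    (suc zero) (suc zero) = refl
laplacian-𝔾 (suc m) u v =
  trans (laplacian-𝔾-suc m u v) (prepend-cong 0ℤ (+ 4) (ℤ.- + 2) lower-levels u v)
  where
  lower-levels : ∀ a b → diag₀ (+ 4) a b ℤ.+ + 2 ℤ.* laplacian (𝔾 m) a b ≡
                         layered 0ℤ m (λ k → δ (suc m) (suc k)) (λ k → κ (suc k)) (κ (suc m)) a b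
  lower-levels a b =
    trans (cong (λ x → diag₀ (+ 4) a b ℤ.+ x)
                (trans (cong (+ 2 ℤ.*_) (laplacian-𝔾 m a b)) (layered-map (+ 2 ℤ.*_) refl m (δ m) κ (κ m) a b)))
          (diag₀-+-layered (+ 4) m (λ k → + 2 ℤ.* δ m k) (λ k → + 2 ℤ.* κ k) (+ 2 ℤ.* κ m) a b)

charEntry-couple : ∀ {N} c (b : Fin (suc (suc N))) → [] -ₚ C (couple 0ℤ c b) ≈ couple [] (C (ℤ.- c)) b
charEntry-couple c zero          = ≈-refl
charEntry-couple c (suc zero)    = ≈-refl
charEntry-couple c (suc (suc b)) = ∷-zero refl ≈-refl

charEntry-layered : ∀ m d c e u v →
  (if u == v then X else []) -ₚ C (layered 0ℤ m d c e u v) ≈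
    layered [] m (λ k → X -ₚ C (d k)) (λ k → C (ℤ.- c k)) (C (ℤ.- e)) u v
charEntry-layered zero    d c e zero          zero          = ≈-refl
charEntry-layered zero    d c e zero          (suc zero)    = ≈-refl
charEntry-layered zero    d c e (suc zero)    zero          = ≈-refl
charEntry-layered zero    d c e (suc zero)    (suc zero)    = ≈-refl
charEntry-layered (suc m) d c e zero          zero          = ≈-refl
charEntry-layered (suc m) d c e zero          (suc zero)    = ∷-zero refl ≈-refl
charEntry-layered (suc m) d c e (suc zero)    zero          = ∷-zero refl ≈-refl
charEntry-layered (suc m) d c e (suc zero)    (suc zero)    = ≈-refl
charEntry-layered (suc m) d c e zero          (suc (suc b)) = charEntry-couple (c 0) b
charEntry-layered (suc m) d c e (suc zero)    (suc (suc b)) = charEntry-couple (c 0) b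
charEntry-layered (suc m) d c e (suc (suc a)) zero          = charEntry-couple (c 0) a
charEntry-layered (suc m) d c e (suc (suc a)) (suc zero)    = charEntry-couple (c 0) a
charEntry-layered (suc m) d c e (suc (suc a)) (suc (suc b)) rewrite ==-suc-suc a b =
  charEntry-layered m (λ k → d (suc k)) (λ k → c (suc k)) e a b

diagonal𝔾 : ℕ → ℕ → Poly
diagonal𝔾 m k = X -ₚ C (δ m k)

coupling𝔾 : ℕ → Poly
coupling𝔾 k = C (ℤ.- κ k)

ψ-layered : ∀ m →
  ψ (suc m) ≈ prodₚ (applyUpTo (addAt m (-ₚ coupling𝔾 m) (diagonal𝔾 m)) (suc m))
                *ₚ continuant (addAt m (coupling𝔾 m) (diagonal𝔾 m))
                              (λ k → C (+ 4) *ₚ coupling𝔾 k *ₚ coupling𝔾 k) (suc m)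
ψ-layered m =
  ≈-trans (det-cong (suc m ℕ.* 2) λ u v →
             ≈-trans (≡⇒≈ (cong (λ x → (if u == v then X else []) -ₚ C x) (laplacian-𝔾 m u v)))
                     (charEntry-layered m (δ m) κ (κ m) u v))
          (det-layered m (diagonal𝔾 m) coupling𝔾 (coupling𝔾 m))

-- Closed forms for 𝔾

2^-square : ∀ j → 2 ^ j ℕ.* 2 ^ j ≡ 4 ^ j
2^-square zero    = refl
2^-square (suc j) = trans (regroup (2 ^ j)) (cong (4 ℕ.*_) (2^-square j))
  where
  regroup : ∀ x → (2 ℕ.* x) ℕ.* (2 ℕ.* x) ≡ 4 ℕ.* (x ℕ.* x)
  regroup = solve-∀

-κ≡2^suc : ∀ k → ℤ.- κ k ≡ + (2 ^ suc k)
-κ≡2^suc zero    = refl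
-κ≡2^suc (suc k) = begin
  ℤ.- (+ 2 ℤ.* κ k)      ≡⟨ ℤP.neg-distribʳ-* (+ 2) (κ k) ⟩
  + 2 ℤ.* ℤ.- κ k        ≡⟨ cong (+ 2 ℤ.*_) (-κ≡2^suc k) ⟩
  + 2 ℤ.* + (2 ^ suc k)  ≡⟨ sym (ℤP.pos-* 2 (2 ^ suc k)) ⟩
  + (2 ^ suc (suc k))    ∎
  where open ≡-Reasoning

δ-inner : ∀ m k → k < m → δ (suc m) (suc k) ≡ + (3 ℕ.* 2 ^ suc (suc k))
δ-inner (suc m) zero    _         = refl
δ-inner (suc m) (suc k) (s<s k<m) = begin
  + 2 ℤ.* δ (suc m) (suc k)                ≡⟨ cong (+ 2 ℤ.*_) (δ-inner m k k<m) ⟩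
  + 2 ℤ.* + (3 ℕ.* 2 ^ suc (suc k))        ≡⟨ sym (ℤP.pos-* 2 (3 ℕ.* 2 ^ suc (suc k))) ⟩
  + (2 ℕ.* (3 ℕ.* 2 ^ suc (suc k)))        ≡⟨ cong +_ (swap (2 ^ suc (suc k))) ⟩
  + (3 ℕ.* 2 ^ suc (suc (suc k)))          ∎
  where
  open ≡-Reasoning
  swap : ∀ x → 2 ℕ.* (3 ℕ.* x) ≡ 3 ℕ.* (2 ℕ.* x)
  swap = solve-∀

δ-last : ∀ m → δ (suc m) (suc m) ≡ + (2 ^ suc (suc (suc m)))
δ-last zero    = refl
δ-last (suc m) = trans (cong (+ 2 ℤ.*_) (δ-last m)) (sym (ℤP.pos-* 2 (2 ^ suc (suc (suc m)))))

4κ²≡4^ : ∀ k → + 4 ℤ.* ℤ.- κ k ℤ.* ℤ.- κ k ≡ + (4 ^ suc (suc k))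
4κ²≡4^ k = begin
  + 4 ℤ.* ℤ.- κ k ℤ.* ℤ.- κ k                    ≡⟨ cong (λ x → + 4 ℤ.* x ℤ.* x) (-κ≡2^suc k) ⟩
  + 4 ℤ.* + (2 ^ suc k) ℤ.* + (2 ^ suc k)        ≡⟨ cong (λ x → x ℤ.* + (2 ^ suc k)) (sym (ℤP.pos-* 4 (2 ^ suc k))) ⟩
  + (4 ℕ.* 2 ^ suc k) ℤ.* + (2 ^ suc k)          ≡⟨ sym (ℤP.pos-* (4 ℕ.* 2 ^ suc k) (2 ^ suc k)) ⟩
  + (4 ℕ.* 2 ^ suc k ℕ.* 2 ^ suc k)              ≡⟨ cong +_ (trans (ℕP.*-assoc 4 (2 ^ suc k) _)
                                                                   (cong (4 ℕ.*_) (2^-square (suc k)))) ⟩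
  + (4 ^ suc (suc k))                            ∎
  where open ≡-Reasoning

weight-closed : ∀ k → C (+ 4) *ₚ coupling𝔾 k *ₚ coupling𝔾 k ≈ C (+ (4 ^ suc (suc k)))
weight-closed k = begin
  C (+ 4) *ₚ C (ℤ.- κ k) *ₚ C (ℤ.- κ k)   ≈⟨ ≈-sym (≈-trans (C-* (+ 4 ℤ.* ℤ.- κ k) (ℤ.- κ k))
                                                       (*ₚ-congˡ (C (ℤ.- κ k)) (C-* (+ 4) (ℤ.- κ k)))) ⟩
  C (+ 4 ℤ.* ℤ.- κ k ℤ.* ℤ.- κ k)         ≡⟨ cong C (4κ²≡4^ k) ⟩
  C (+ (4 ^ suc (suc k)))                 ∎
  where open ≈-Reasoning

gDiagonal : ℕ → Poly
gDiagonal = (X -ₚ C (+ 4)) ∷ˢ (λ k → X -ₚ C (+ (3 ℕ.* 2 ^ suc (suc k))))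

gWeight : ℕ → Poly
gWeight k = C (+ (2 ^ (2 ℕ.* suc (suc k))))

g-continuant : ∀ k → g k ≡ continuant gDiagonal gWeight k
g-continuant zero          = refl
g-continuant (suc zero)    = refl
g-continuant (suc (suc k)) =
  cong₂ (λ p q → gDiagonal (suc k) *ₚ p -ₚ gWeight k *ₚ q) (g-continuant (suc k)) (g-continuant k)

C-pos-* : ∀ a b → C (+ (a ℕ.* b)) ≈ C (+ a) *ₚ C (+ b)
C-pos-* a b = ≈-trans (≡⇒≈ (cong C (ℤP.pos-* a b))) (C-* (+ a) (+ b))

X-2x+x : ∀ x → X -ₚ C (+ (2 ℕ.* x)) +ₚ C (+ x) ≈ X -ₚ C (+ x)
X-2x+x x =
  ≈-trans (+ₚ-cong (+ₚ-congˡ X (-ₚ-cong (C-pos-* 2 x))) (≈-refl {C (+ x)}))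
    (solve 2 (λ X y → X :- con (+ 2) :* y :+ y := X :- y) ≈-refl X (C (+ x)))

X-2x-x : ∀ x → X -ₚ C (+ (2 ℕ.* x)) -ₚ C (+ x) ≈ X -ₚ C (+ (3 ℕ.* x))
X-2x-x x =
  ≈-trans (+ₚ-cong (+ₚ-congˡ X (-ₚ-cong (C-pos-* 2 x))) (≈-refl { -ₚ C (+ x)}))
    (≈-trans (solve 2 (λ X y → X :- con (+ 2) :* y :- y := X :- con (+ 3) :* y) ≈-refl X (C (+ x)))
      (+ₚ-congˡ X (-ₚ-cong (≈-sym (C-pos-* 3 x)))))

diagonal𝔾-inner : ∀ m k → k < suc m → diagonal𝔾 (suc m) k ≡ gDiagonal k
diagonal𝔾-inner m zero    _         = refl
diagonal𝔾-inner m (suc k) (s<s k<m) = cong (λ x → X -ₚ C x) (δ-inner m k k<m)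

coupling𝔾-closed : ∀ k → coupling𝔾 k ≡ C (+ (2 ^ suc k))
coupling𝔾-closed k = cong C (-κ≡2^suc k)

prodₚ-applyUpTo-cong : ∀ n {s : ℕ → Poly} (f : ℕ → Poly) (h : ℕ → ℕ) → (∀ k → k < n → s k ≈ f (h k)) →
                       prodₚ (applyUpTo s n) ≈ prodₚ (map f (applyUpTo h n))
prodₚ-applyUpTo-cong zero    f h s≈fh = ≈-refl
prodₚ-applyUpTo-cong (suc n) f h s≈fh =
  *ₚ-cong (s≈fh 0 z<s) (prodₚ-applyUpTo-cong n f (λ k → h (suc k)) (λ k k<n → s≈fh (suc k) (s<s k<n)))

product-closed : ∀ m →
  prodₚ (applyUpTo (addAt (suc m) (-ₚ coupling𝔾 (suc m)) (diagonal𝔾 (suc m))) (suc (suc m)))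
    ≈ (X -ₚ C (+ 4)) *ₚ prodFactor (suc (suc m))
product-closed m =
  *ₚ-congʳ (X -ₚ C (+ 4))
    (prodₚ-applyUpTo-cong (suc m) (λ i → X -ₚ C (+ (3 ℕ.* 2 ^ i))) (λ k → suc (suc k)) factor)
  where
  factor : ∀ k → k < suc m →
           addAt m (-ₚ coupling𝔾 (suc m)) (λ k → diagonal𝔾 (suc m) (suc k)) k
             ≈ X -ₚ C (+ (3 ℕ.* 2 ^ suc (suc k)))
  factor k k<1+m with ℕP.m<1+n⇒m<n∨m≡n k<1+m
  ... | inj₁ k<m  = ≡⇒≈ (trans (addAt-< m (-ₚ coupling𝔾 (suc m)) (λ k → diagonal𝔾 (suc m) (suc k)) k k<m)
                                (diagonal𝔾-inner m (suc k) (s<s k<m)))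
  ... | inj₂ refl = ≈-trans (≡⇒≈ (trans (addAt-self k (-ₚ coupling𝔾 (suc k)) (λ j → diagonal𝔾 (suc k) (suc j)))
                              (cong₂ (λ x y → X -ₚ C x -ₚ y) (δ-last k) (coupling𝔾-closed (suc k)))))
                            (X-2x-x (2 ^ suc (suc k)))

continuant-closed : ∀ m →
  continuant (addAt (suc m) (coupling𝔾 (suc m)) (diagonal𝔾 (suc m)))
             (λ k → C (+ 4) *ₚ coupling𝔾 k *ₚ coupling𝔾 k) (suc (suc m))
    ≈ (X -ₚ C (+ (2 ^ suc (suc m)))) *ₚ g (suc m) -ₚ C (+ (4 ^ suc (suc m))) *ₚ g m
continuant-closed m =
  +ₚ-cong (*ₚ-cong last-level (lower-levels (suc m) ℕP.≤-refl))
          (-ₚ-cong (*ₚ-cong (weight-closed m) (lower-levels m (ℕP.n≤1+n m))))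
  where
  a = addAt (suc m) (coupling𝔾 (suc m)) (diagonal𝔾 (suc m))
  w = λ k → C (+ 4) *ₚ coupling𝔾 k *ₚ coupling𝔾 k
  last-level : a (suc m) ≈ X -ₚ C (+ (2 ^ suc (suc m)))
  last-level = ≈-trans (≡⇒≈ (trans (addAt-self (suc m) (coupling𝔾 (suc m)) (diagonal𝔾 (suc m)))
                         (cong₂ (λ x y → X -ₚ C x +ₚ y) (δ-last m) (coupling𝔾-closed (suc m)))))
                       (X-2x+x (2 ^ suc (suc m)))
  w≈gWeight : ∀ k → w k ≈ gWeight k
  w≈gWeight k = ≈-trans (weight-closed k) (≡⇒≈ (cong (λ x → C (+ x)) (ℕP.^-*-assoc 2 2 (suc (suc k)))))
  lower-levels : ∀ j → j ℕ.≤ suc m → continuant a w j ≈ g j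
  lower-levels j j≤1+m = ≈-trans (continuant-cong j a≈gDiagonal w≈gWeight) (≡⇒≈ (sym (g-continuant j)))
    where
    a≈gDiagonal : ∀ k → k < j → a k ≈ gDiagonal k
    a≈gDiagonal k k<j = ≡⇒≈ (trans (addAt-< (suc m) (coupling𝔾 (suc m)) (diagonal𝔾 (suc m)) k k<1+m)
                                   (diagonal𝔾-inner m k k<1+m))
      where k<1+m = ℕP.<-≤-trans k<j j≤1+m

theorem3p1 : (ψ 1 ≈ₚ X *ₚ (X -ₚ C (+ 4)))
    × (∀ (m : ℕ) → let n = suc (suc m) in
    ψ n ≈ₚ ((X -ₚ C (+ (2 ^ n))) *ₚ g (suc m) -ₚ C (+ (4 ^ n)) *ₚ g m)
    *ₚ (X -ₚ C (+ 4)) *ₚ prodFactor n)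
theorem3p1 = get ψ₁ , λ m → get (ψ₂₊ m)
  where
  open ≈-Reasoning
  ψ₁ : ψ 1 ≈ X *ₚ (X -ₚ C (+ 4))
  ψ₁ = ≈-trans (ψ-layered 0)
         (solve 1 (λ X → (X :- con (+ 2) :- con (+ 2)) :* con 1ℤ :* (X :- con (+ 2) :+ con (+ 2))
                         := X :* (X :- con (+ 4))) ≈-refl X)
  ψ₂₊ : ∀ m → ψ (suc (suc m)) ≈ ((X -ₚ C (+ (2 ^ suc (suc m)))) *ₚ g (suc m) -ₚ C (+ (4 ^ suc (suc m))) *ₚ g m)
                                  *ₚ (X -ₚ C (+ 4)) *ₚ prodFactor (suc (suc m))
  ψ₂₊ m = begin
    ψ (suc (suc m))            ≈⟨ ψ-layered (suc m) ⟩
    _                          ≈⟨ *ₚ-cong (product-closed m) (continuant-closed m) ⟩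
    (X -ₚ C (+ 4)) *ₚ P *ₚ G   ≈⟨ solve 3 (λ x p q → x :* p :* q := q :* x :* p) ≈-refl (X -ₚ C (+ 4)) P G ⟩
    G *ₚ (X -ₚ C (+ 4)) *ₚ P   ∎
    where
    P = prodFactor (suc (suc m))
    G = (X -ₚ C (+ (2 ^ suc (suc m)))) *ₚ g (suc m) -ₚ C (+ (4 ^ suc (suc m))) *ₚ g m
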